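{- Let $X=\mathcal{M}_O(n,a,b)$ be feasible with $a>1$, and suppose the edge $[v_0,v_a]$ lies in $\mathcal{B}$. Then $X$ admits an automorphism fixing $u_0$ and cyclically permuting the sets $\mathcal{R},\mathcal{B},\mathcal{G}$ if and only if $n\equiv 8\pmod{16}$, $a=4a_0+1<n/4-1$ where $a_0$ is odd and $8(a_0^2+a_0+1)\equiv 0\pmod n$, and $b=n/2+a+2$.
   Context: For even $n\ge4$ and odd $0<a<b<n$, $\mathcal{M}_O(n,a,b)$ has vertices $u_0,\dots,u_{n-1},v_0,\dots,v_{n-1}$ and edges $[u_i,u_{i+1}]$, $[u_i,v_i]$ for all $i$ and $[v_i,v_{i+a}]$, $[v_i,v_{i+b}]$ for even $i$ (subscripts mod $n$). It is feasible if $\gcd(b-a,n)=2$, $(b-a)^2/2\equiv 2\pmod n$, at least one of $a+(a-1)(a-b)/2\equiv1$ or $b+(b-1)(b-a)/2\equiv 1\pmod n$ holds, and $1\le a<b-2<n-a-2$. Let $x=a$ if $a+(a-1)(a-b)/2\equiv 1\pmod n$ and $x=b$ otherwise, and $y$ the other element of $\{a,b\}$. $\mathcal{R}=\{[u_i,v_i]\}$; $\mathcal{B}=\{[u_i,u_{i+1}]: i\text{ even}\}\cup\{[v_j,v_{j+x}]: j\text{ even}\}$; $\mathcal{G}=\{[u_i,u_{i+1}]: i\text{ odd}\}\cup\{[v_j,v_{j+y}]: j\text{ even}\}$. -}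

module Defs where

open import Data.Nat as ℕ using (ℕ; _+_; _*_; _∸_; _<_; _≤_; _/_)
open import Data.Nat.GCD using (gcd)
open import Data.Nat.Divisibility as ND using ()
open import Data.Integer as ℤ using (ℤ; +_)
open import Data.Integer.Divisibility as ZD using ()
open import Data.Fin using (Fin; toℕ)
open import Data.Product using (Σ; _×_; _,_)
open import Data.Sum using (_⊎_)
open import Data.Empty using (⊥)
open import Relation.Nullary using (¬_)
open import Relation.Binary.PropositionalEquality using (_≡_)
open import Function.Definitions using (Bijective)

Even : ℕ → Set
Even m = 2 ND.∣ m

Odd : ℕ → Set
Odd m = ¬ Even m

Cong : ℕ → ℤ → ℤ → Set
Cong n x y = (+ n) ZD.∣ (x ℤ.- y)

-- vertices: (U , i) is u_i, (V , i) is v_i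
data Side : Set where
  U V : Side

Vert : ℕ → Set
Vert n = Side × Fin n

StepTo : (n s : ℕ) → Fin n → Fin n → Set
StepTo n s i j = Cong n (+ toℕ j) (+ (toℕ i + s))

VStep : (n s : ℕ) → Fin n → Fin n → Set
VStep n s i j = Even (toℕ i) × StepTo n s i j

Sym : {A : Set} → (A → A → Set) → A → A → Set
Sym E p q = E p q ⊎ E q p

-- ordered "half edges" of M_O(n,a,b)
EdgeH : (n a b : ℕ) → Vert n → Vert n → Set
EdgeH n a b (U , i) (U , j) = StepTo n 1 i j
EdgeH n a b (U , i) (V , j) = i ≡ j
EdgeH n a b (V , i) (V , j) = VStep n a i j ⊎ VStep n b i j
EdgeH n a b _ _ = ⊥

Adj : (n a b : ℕ) → Vert n → Vert n → Set
Adj n a b = Sym (EdgeH n a b)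

CondA : ℕ → ℕ → ℕ → Set
CondA n a b = Cong n (+ a ℤ.- + (((a ∸ 1) * (b ∸ a)) / 2)) (+ 1)

CondB : ℕ → ℕ → ℕ → Set
CondB n a b = Cong n (+ (b + ((b ∸ 1) * (b ∸ a)) / 2)) (+ 1)

Feasible : ℕ → ℕ → ℕ → Set
Feasible n a b =
  gcd (b ∸ a) n ≡ 2
  × Cong n (+ (((b ∸ a) * (b ∸ a)) / 2)) (+ 2)
  × (CondA n a b ⊎ CondB n a b)
  × 1 ≤ a × a < b ∸ 2 × b ∸ 2 < n ∸ a ∸ 2

-- x = a if CondA holds, x = b otherwise; y is the other one.
-- v-edges with step x / step y:
VX : (n a b : ℕ) → Fin n → Fin n → Set
VX n a b i j = (CondA n a b × VStep n a i j) ⊎ (¬ CondA n a b × VStep n b i j)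

VY : (n a b : ℕ) → Fin n → Fin n → Set
VY n a b i j = (CondA n a b × VStep n b i j) ⊎ (¬ CondA n a b × VStep n a i j)

RH : (n a b : ℕ) → Vert n → Vert n → Set
RH n a b (U , i) (V , j) = i ≡ j
RH n a b _ _ = ⊥

BH : (n a b : ℕ) → Vert n → Vert n → Set
BH n a b (U , i) (U , j) = Even (toℕ i) × StepTo n 1 i j
BH n a b (V , i) (V , j) = VX n a b i j
BH n a b _ _ = ⊥

GH : (n a b : ℕ) → Vert n → Vert n → Set
GH n a b (U , i) (U , j) = Odd (toℕ i) × StepTo n 1 i j
GH n a b (V , i) (V , j) = VY n a b i j
GH n a b _ _ = ⊥

InR InB InG : (n a b : ℕ) → Vert n → Vert n → Set
InR n a b = Sym (RH n a b)
InB n a b = Sym (BH n a b)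
InG n a b = Sym (GH n a b)

MapsOnto : {A : Set} → (A → A) → (A → A → Set) → (A → A → Set) → Set
MapsOnto {A} σ E F = (p q : A) → (E p q → F (σ p) (σ q)) × (F (σ p) (σ q) → E p q)

IsAutomorphism : (n a b : ℕ) → (Vert n → Vert n) → Set
IsAutomorphism n a b σ = Bijective _≡_ _≡_ σ × MapsOnto σ (Adj n a b) (Adj n a b)

FixesU0 : (n : ℕ) → (Vert n → Vert n) → Set
FixesU0 n σ = (i : Fin n) → toℕ i ≡ 0 → σ (U , i) ≡ (U , i)

CyclicRBG : (n a b : ℕ) → (Vert n → Vert n) → Set
CyclicRBG n a b σ =
  (MapsOnto σ (InR n a b) (InB n a b) × MapsOnto σ (InB n a b) (InG n a b) × MapsOnto σ (InG n a b) (InR n a b))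
  ⊎ (MapsOnto σ (InR n a b) (InG n a b) × MapsOnto σ (InG n a b) (InB n a b) × MapsOnto σ (InB n a b) (InR n a b))

-- The colour classes ℛ, ℬ, 𝒢 of M_O(n,a,b) are perfect matchings, i.e. graphs of involutions
-- R, B, G, and an automorphism fixing u₀ that permutes them cyclically is, after replacing σ by
-- σ² if necessary, a map with σR = Gσ, σG = Bσ, σB = Rσ. Conversely such a rotation fixing u₀ is
-- an automorphism: u₀ reaches every vertex through R, B, G, so a map commuting with the colours
-- is determined by the image of u₀, whence σ³ = id. The same rigidity shows that a rotation
-- satisfies σ(s_{i+4}) = σ(s_i) + (a − 1), and following the colours from u₀ gives
-- σ(u₁), σ(u₂), σ(u₃) = v₀, v_a, u_a. Computing σ(v_a), σ(v_b) and σ(v_{b+2}) in two ways then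
-- shows that a rotation exists exactly when 4 ∣ n, a = 4a₀ + 1, b = 4b₀ + 3 and n divides
-- 4(a₀² + b₀ + 1), 4(a₀b₀ + a₀ + 1) and 8(b₀ − a₀). The feasibility bounds give
-- 0 < b₀ − a₀ < n/4, hence n = 8(b₀ − a₀), and parity forces a₀ and b₀ − a₀ to be odd.

module Submission where

module ColourRotations where

  open import Defs
  open import Data.Nat as ℕ using (ℕ; zero; suc; NonZero; _∸_)
  import Data.Nat.Properties as ℕP
  import Data.Nat.DivMod as ℕD
  import Data.Nat.Divisibility as ℕDiv
  open import Data.Integer using (ℤ; +_; _+_; _*_; _-_; -_; 0ℤ; 1ℤ; -1ℤ; _⊖_; ∣_∣)
  import Data.Integer.Properties as ℤP
  open import Data.Integer.DivMod using (_%ℕ_; _/ℕ_; n%ℕd<d; a≡a%ℕn+[a/ℕn]*n)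
  open import Data.Integer.Divisibility.Signed
  import Data.Integer.Divisibility as Unsigned
  open import Data.Integer.Tactic.RingSolver using (solve-∀; solve)
  import Data.Nat.Tactic.RingSolver as NS
  open import Data.Fin using (Fin; toℕ; fromℕ<)
  import Data.Fin.Properties as FinP
  open import Data.List using ([]; _∷_)
  open import Data.Product using (Σ; _×_; _,_; proj₁; proj₂)
  open import Data.Sum using (_⊎_; inj₁; inj₂)
  open import Data.Empty using (⊥-elim)
  open import Function.Bundles using (_⇔_; mk⇔; Equivalence)
  open import Function.Definitions using (Bijective)
  open import Function.Consequences.Propositional using (inverseᵇ⇒bijective; strictlyInverseˡ⇒inverseˡ; strictlyInverseʳ⇒inverseʳ)
  open import Data.Sum.Function.Propositional using (_⊎-⇔_)
  import Function.Properties.Equivalence as ⇔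
  open import Relation.Binary.PropositionalEquality
  open import Relation.Nullary using (¬_; Dec; yes; no)
  open import Relation.Nullary.Decidable using (True; toWitness)

  -- Integers modulo n

  module Modular (n : ℕ) {{n≢0 : NonZero n}} where

    -- a record rather than a synonym for divisibility, so that x and y are inferable
    infix 4 _≈_
    record _≈_ (x y : ℤ) : Set where
      constructor ≈-intro
      field ∣-diff : + n ∣ x - y

    ≈-by : ∀ {x y e} → + n ∣ e → x - y ≡ e → x ≈ y
    ≈-by n∣e refl = ≈-intro n∣e

    ≈-refl : ∀ {x} → x ≈ x
    ≈-refl {x} = ≈-by (divides 0ℤ refl) (ℤP.+-inverseʳ x)

    ≈-reflexive : ∀ {x y} → x ≡ y → x ≈ y
    ≈-reflexive refl = ≈-refl

    ≈-sym : ∀ {x y} → x ≈ y → y ≈ x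
    ≈-sym {x} {y} (≈-intro n∣x-y) = ≈-by (∣m⇒∣-m n∣x-y) (solve (x ∷ y ∷ []))

    ≈-trans : ∀ {x y z} → x ≈ y → y ≈ z → x ≈ z
    ≈-trans {x} {y} {z} (≈-intro n∣x-y) (≈-intro n∣y-z) = ≈-by (∣m∣n⇒∣m+n n∣x-y n∣y-z) (solve (x ∷ y ∷ z ∷ []))

    ≈-+ʳ : ∀ {x y} z → x ≈ y → x + z ≈ y + z
    ≈-+ʳ {x} {y} z (≈-intro n∣x-y) = ≈-by n∣x-y (solve (x ∷ y ∷ z ∷ []))

    ≈-+ˡ : ∀ {x y} z → x ≈ y → z + x ≈ z + y
    ≈-+ˡ {x} {y} z (≈-intro n∣x-y) = ≈-by n∣x-y (solve (x ∷ y ∷ z ∷ []))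

    residue-unique : ∀ {r s} → r ℕ.< n → s ℕ.< n → + r ≈ + s → r ≡ s
    residue-unique {r} {s} r<n s<n n∣r-s with ∣ r ⊖ s ∣ in eq
    ... | zero = ℤP.+-injective (ℤP.i-j≡0⇒i≡j (+ r) (+ s) (trans (ℤP.m-n≡m⊖n r s) (ℤP.∣i∣≡0⇒i≡0 eq)))
    ... | suc d = ⊥-elim (ℕDiv.>⇒∤ d<n (subst (n ℕDiv.∣_) (trans (cong ∣_∣ (ℤP.m-n≡m⊖n r s)) eq) (∣⇒∣ᵤ (_≈_.∣-diff n∣r-s))))
      where
      d<n : suc d ℕ.< n
      d<n = subst (ℕ._< n) eq (ℕP.≤-<-trans (ℤP.∣m⊝n∣≤m⊔n r s) (ℕP.⊔-lub r<n s<n))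

    -- opaque: unfolding the remainder makes conversion checking on vertices explode
    opaque
      fromℤ : ℤ → Fin n
      fromℤ z = fromℕ< (n%ℕd<d z n)

      toℕ-fromℤ≈ : ∀ z → + toℕ (fromℤ z) ≈ z
      toℕ-fromℤ≈ z = ≈-sym (≈-intro (divides (z /ℕ n) eq))
        where
        eq : z - + toℕ (fromℤ z) ≡ z /ℕ n * + n
        eq = begin
          z - + toℕ (fromℤ z)   ≡⟨ cong (λ r → z - + r) (FinP.toℕ-fromℕ< (n%ℕd<d z n)) ⟩
          z - + (z %ℕ n)         ≡⟨ cong (_- + (z %ℕ n)) (a≡a%ℕn+[a/ℕn]*n z n) ⟩
          + (z %ℕ n) + z /ℕ n * + n - + (z %ℕ n) ≡⟨ cancel (+ (z %ℕ n)) (z /ℕ n * + n) ⟩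
          z /ℕ n * + n           ∎
          where
          open ≡-Reasoning
          cancel : ∀ r q → r + q - r ≡ q
          cancel = solve-∀

      toℕ-fromℤ : ∀ {k} → k ℕ.< n → toℕ (fromℤ (+ k)) ≡ k
      toℕ-fromℤ k<n = trans (FinP.toℕ-fromℕ< _) (ℕD.m<n⇒m%n≡m k<n)

    fromℤ-cong : ∀ {x y} → x ≈ y → fromℤ x ≡ fromℤ y
    fromℤ-cong {x} {y} x≈y = FinP.toℕ-injective (residue-unique (FinP.toℕ<n _) (FinP.toℕ<n _)
      (≈-trans (toℕ-fromℤ≈ x) (≈-trans x≈y (≈-sym (toℕ-fromℤ≈ y)))))

    fromℤ-injective : ∀ {x y} → fromℤ x ≡ fromℤ y → x ≈ y
    fromℤ-injective {x} {y} eq = ≈-trans (≈-sym (toℕ-fromℤ≈ x)) (subst (λ i → + toℕ i ≈ y) (sym eq) (toℕ-fromℤ≈ y))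

    fromℤ-toℕ : ∀ i → fromℤ (+ toℕ i) ≡ i
    fromℤ-toℕ i = FinP.toℕ-injective (residue-unique (FinP.toℕ<n _) (FinP.toℕ<n i) (toℕ-fromℤ≈ (+ toℕ i)))

    infixl 6 _⊕_
    _⊕_ : Fin n → ℤ → Fin n
    i ⊕ z = fromℤ (+ toℕ i + z)

    fromℤ-⊕ : ∀ x z → fromℤ x ⊕ z ≡ fromℤ (x + z)
    fromℤ-⊕ x z = fromℤ-cong (≈-+ʳ z (toℕ-fromℤ≈ x))

    ⊕-⊕ : ∀ i x y → i ⊕ x ⊕ y ≡ i ⊕ (x + y)
    ⊕-⊕ i x y = trans (fromℤ-⊕ (+ toℕ i + x) y) (cong fromℤ (ℤP.+-assoc (+ toℕ i) x y))

    ⊕-cancel : ∀ i x → i ⊕ x ⊕ - x ≡ i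
    ⊕-cancel i x = trans (⊕-⊕ i x (- x)) (trans (cong (λ z → fromℤ (+ toℕ i + z)) (ℤP.+-inverseʳ x))
      (trans (cong fromℤ (ℤP.+-identityʳ (+ toℕ i))) (fromℤ-toℕ i)))

    ⊕-cancelʳ : ∀ i x → i ⊕ - x ⊕ x ≡ i
    ⊕-cancelʳ i x = trans (cong (i ⊕ - x ⊕_) (sym (ℤP.neg-involutive x))) (⊕-cancel i (- x))

    StepTo⇔ : ∀ s i j → StepTo n s i j ⇔ j ≡ i ⊕ + s
    StepTo⇔ s i j = mk⇔ to from
      where
      pos-sum : + (toℕ i ℕ.+ s) ≡ + toℕ i + + s
      pos-sum = ℤP.pos-+ (toℕ i) s
      to : StepTo n s i j → j ≡ i ⊕ + s
      to st = trans (sym (fromℤ-toℕ j)) (trans (fromℤ-cong (≈-intro {+ toℕ j} {+ (toℕ i ℕ.+ s)} (∣ᵤ⇒∣ st))) (cong fromℤ pos-sum))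
      from : j ≡ i ⊕ + s → StepTo n s i j
      from refl = subst (λ z → (+ n) Unsigned.∣ (+ toℕ (i ⊕ + s) - z)) (sym pos-sum) (∣⇒∣ᵤ (_≈_.∣-diff (toℕ-fromℤ≈ (+ toℕ i + + s))))

  ∣-≡ : ∀ {d e e′} → d ∣ e → e ≡ e′ → d ∣ e′
  ∣-≡ d∣e refl = d∣e

  -- records for the same reason as _≈_
  record Evenℤ (z : ℤ) : Set where
    constructor evenℤ
    field 2∣z : + 2 ∣ z

  record Oddℤ (z : ℤ) : Set where
    constructor oddℤ
    field 2∣1+z : + 2 ∣ 1ℤ + z

  even+even : ∀ {x y} → Evenℤ x → Evenℤ y → Evenℤ (x + y)
  even+even (evenℤ 2∣x) (evenℤ 2∣y) = evenℤ (∣m∣n⇒∣m+n 2∣x 2∣y)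

  even+odd : ∀ {x y} → Evenℤ x → Oddℤ y → Oddℤ (x + y)
  even+odd {x} {y} (evenℤ 2∣x) (oddℤ 2∣1+y) = oddℤ (∣-≡ (∣m∣n⇒∣m+n 2∣x 2∣1+y) (solve (x ∷ y ∷ [])))

  odd+even : ∀ {x y} → Oddℤ x → Evenℤ y → Oddℤ (x + y)
  odd+even {x} {y} (oddℤ 2∣1+x) (evenℤ 2∣y) = oddℤ (∣-≡ (∣m∣n⇒∣m+n 2∣1+x 2∣y) (solve (x ∷ y ∷ [])))

  odd-odd : ∀ {x y} → Oddℤ x → Oddℤ y → Evenℤ (x - y)
  odd-odd {x} {y} (oddℤ 2∣1+x) (oddℤ 2∣1+y) = evenℤ (∣-≡ (∣m∣n⇒∣m-n 2∣1+x 2∣1+y) (solve (x ∷ y ∷ [])))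

  odd+odd : ∀ {x y} → Oddℤ x → Oddℤ y → Evenℤ (x + y)
  odd+odd {x} {y} (oddℤ 2∣1+x) (oddℤ 2∣1+y) = evenℤ (∣-≡ (∣m∣n⇒∣m-n (∣m∣n⇒∣m+n 2∣1+x 2∣1+y) (∣-refl {+ 2})) (solve (x ∷ y ∷ [])))

  odd-neg : ∀ {y} → Oddℤ y → Oddℤ (- y)
  odd-neg {y} (oddℤ 2∣1+y) = oddℤ (∣-≡ (∣m∣n⇒∣m-n (∣-refl {+ 2}) 2∣1+y) (solve (y ∷ [])))

  odd⇒pred-even : ∀ {x} → Oddℤ x → Evenℤ (x - 1ℤ)
  odd⇒pred-even {x} (oddℤ 2∣1+x) = evenℤ (∣-≡ (∣m∣n⇒∣m-n 2∣1+x (∣-refl {+ 2})) (solve (x ∷ [])))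

  1-odd : Odd 1
  1-odd 2∣1 with ℕDiv.∣1⇒≡1 2∣1
  ... | ()

  2∤1 : ¬ + 2 ∣ 1ℤ
  2∤1 2∣1 with ℕDiv.∣1⇒≡1 (∣⇒∣ᵤ 2∣1)
  ... | ()

  odd⇒suc-even : ∀ k → Odd k → Even (suc k)
  odd⇒suc-even zero odd = ⊥-elim (odd (2 ℕDiv.∣0))
  odd⇒suc-even (suc zero) _ = ℕDiv.divides 1 refl
  odd⇒suc-even (suc (suc k)) odd =
    ℕDiv.∣m∣n⇒∣m+n ℕDiv.∣-refl (odd⇒suc-even k (λ 2∣k → odd (ℕDiv.∣m∣n⇒∣m+n ℕDiv.∣-refl 2∣k)))

  odd⇒2f+1 : ∀ {k} → Odd k → Σ ℕ λ f → k ≡ 2 ℕ.* f ℕ.+ 1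
  odd⇒2f+1 {k} odd with odd⇒suc-even k odd
  ... | ℕDiv.divides (suc f) k+1≡ = f , trans (ℕP.suc-injective k+1≡) (regroup f)
    where
    regroup : ∀ f → suc (f ℕ.* 2) ≡ 2 ℕ.* f ℕ.+ 1
    regroup = NS.solve-∀

  even⇒Evenℤ : ∀ {k} → Even k → Evenℤ (+ k)
  even⇒Evenℤ ev = evenℤ (∣ᵤ⇒∣ ev)

  odd⇒Oddℤ : ∀ {k} → Odd k → Oddℤ (+ k)
  odd⇒Oddℤ {k} odd = oddℤ (∣ᵤ⇒∣ (odd⇒suc-even k odd))

  module Parity (n : ℕ) {{n≢0 : NonZero n}} (n-even : Even n) where

    open Modular n

    2∣-≈ : ∀ {x y} → + 2 ∣ x → x ≈ y → + 2 ∣ y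
    2∣-≈ {x} {y} 2∣x (≈-intro n∣x-y) = ∣-≡ (∣m∣n⇒∣m-n 2∣x (∣-trans (∣ᵤ⇒∣ n-even) n∣x-y)) (solve (x ∷ y ∷ []))

    toℕ-fromℤ-even : ∀ {z} → Evenℤ z → Even (toℕ (fromℤ z))
    toℕ-fromℤ-even (evenℤ 2∣z) = ∣⇒∣ᵤ (2∣-≈ 2∣z (≈-sym (toℕ-fromℤ≈ _)))

    toℕ-fromℤ-odd : ∀ {z} → Oddℤ z → Odd (toℕ (fromℤ z))
    toℕ-fromℤ-odd {z} (oddℤ 2∣1+z) 2∣k = 2∤1 (∣m+n∣n⇒∣m {m = 1ℤ} 2∣1+k (∣ᵤ⇒∣ {i = + toℕ (fromℤ z)} 2∣k))
      where
      2∣1+k : + 2 ∣ 1ℤ + + toℕ (fromℤ z)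
      2∣1+k = 2∣-≈ 2∣1+z (≈-+ˡ 1ℤ (≈-sym (toℕ-fromℤ≈ z)))

    opaque
      flip : ℤ → Fin n → Fin n
      flip δ i with 2 ℕDiv.∣? toℕ i
      ... | yes _ = i ⊕ δ
      ... | no _ = i ⊕ - δ

      flip-even : ∀ δ {i} → Even (toℕ i) → flip δ i ≡ i ⊕ δ
      flip-even δ {i} ev with 2 ℕDiv.∣? toℕ i
      ... | yes _ = refl
      ... | no odd = ⊥-elim (odd ev)

      flip-odd : ∀ δ {i} → Odd (toℕ i) → flip δ i ≡ i ⊕ - δ
      flip-odd δ {i} odd with 2 ℕDiv.∣? toℕ i
      ... | yes ev = ⊥-elim (odd ev)
      ... | no _ = refl

    flip-fromℤ-even : ∀ δ {z} → Evenℤ z → flip δ (fromℤ z) ≡ fromℤ (z + δ)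
    flip-fromℤ-even δ {z} ev = trans (flip-even δ (toℕ-fromℤ-even ev)) (fromℤ-⊕ z δ)

    flip-fromℤ-odd : ∀ δ {z} → Oddℤ z → flip δ (fromℤ z) ≡ fromℤ (z - δ)
    flip-fromℤ-odd δ {z} odd = trans (flip-odd δ (toℕ-fromℤ-odd odd)) (fromℤ-⊕ z (- δ))

    flip-involutive : ∀ {δ} → Oddℤ δ → ∀ i → flip δ (flip δ i) ≡ i
    flip-involutive {δ} oddδ i with 2 ℕDiv.∣? toℕ i
    ... | yes ev = begin
      flip δ (flip δ i)    ≡⟨ cong (flip δ) (flip-even δ ev) ⟩
      flip δ (i ⊕ δ)       ≡⟨ flip-odd δ (toℕ-fromℤ-odd (even+odd (even⇒Evenℤ ev) oddδ)) ⟩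
      i ⊕ δ ⊕ - δ          ≡⟨ ⊕-cancel i δ ⟩
      i                    ∎
      where open ≡-Reasoning
    ... | no odd = begin
      flip δ (flip δ i)    ≡⟨ cong (flip δ) (flip-odd δ odd) ⟩
      flip δ (i ⊕ - δ)     ≡⟨ flip-even δ (toℕ-fromℤ-even (odd-odd (odd⇒Oddℤ odd) oddδ)) ⟩
      i ⊕ - δ ⊕ δ          ≡⟨ ⊕-cancelʳ i δ ⟩
      i                    ∎
      where open ≡-Reasoning

    flip-⊕ : ∀ δ {e} → Evenℤ e → ∀ i → flip δ (i ⊕ e) ≡ flip δ i ⊕ e
    flip-⊕ δ {e} 2∣e i with 2 ℕDiv.∣? toℕ i
    ... | yes ev = begin
      flip δ (i ⊕ e)    ≡⟨ flip-even δ (toℕ-fromℤ-even (even+even (even⇒Evenℤ ev) 2∣e)) ⟩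
      i ⊕ e ⊕ δ         ≡⟨ ⊕-⊕ i e δ ⟩
      i ⊕ (e + δ)       ≡⟨ cong (i ⊕_) (ℤP.+-comm e δ) ⟩
      i ⊕ (δ + e)       ≡⟨ ⊕-⊕ i δ e ⟨
      i ⊕ δ ⊕ e         ≡⟨ cong (_⊕ e) (flip-even δ ev) ⟨
      flip δ i ⊕ e      ∎
      where open ≡-Reasoning
    ... | no odd = begin
      flip δ (i ⊕ e)    ≡⟨ flip-odd δ (toℕ-fromℤ-odd (odd+even (odd⇒Oddℤ odd) 2∣e)) ⟩
      i ⊕ e ⊕ - δ       ≡⟨ ⊕-⊕ i e (- δ) ⟩
      i ⊕ (e - δ)       ≡⟨ cong (i ⊕_) (ℤP.+-comm e (- δ)) ⟩
      i ⊕ (- δ + e)     ≡⟨ ⊕-⊕ i (- δ) e ⟨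
      i ⊕ - δ ⊕ e       ≡⟨ cong (_⊕ e) (flip-odd δ odd) ⟨
      flip δ i ⊕ e      ∎
      where open ≡-Reasoning

    EvenStep OddStep : ℕ → Fin n → Fin n → Set
    EvenStep s i j = Even (toℕ i) × StepTo n s i j
    OddStep s i j = Odd (toℕ i) × StepTo n s i j

    Sym-EvenStep⇔flip : ∀ {s} → Odd s → ∀ i j → Sym (EvenStep s) i j ⇔ j ≡ flip (+ s) i
    Sym-EvenStep⇔flip {s} odd-s i j = mk⇔ to from
      where
      to : Sym (EvenStep s) i j → j ≡ flip (+ s) i
      to (inj₁ (ev , st)) = trans (Equivalence.to (StepTo⇔ s i j) st) (sym (flip-even (+ s) ev))
      to (inj₂ (ev , st)) = sym (begin
        flip (+ s) i             ≡⟨ cong (flip (+ s)) (Equivalence.to (StepTo⇔ s j i) st) ⟩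
        flip (+ s) (j ⊕ + s)     ≡⟨ flip-odd (+ s) (toℕ-fromℤ-odd (even+odd (even⇒Evenℤ ev) (odd⇒Oddℤ odd-s))) ⟩
        j ⊕ + s ⊕ - + s          ≡⟨ ⊕-cancel j (+ s) ⟩
        j                        ∎)
        where open ≡-Reasoning
      from : j ≡ flip (+ s) i → Sym (EvenStep s) i j
      from j≡ = by-parity (2 ℕDiv.∣? toℕ i)
        where
        by-parity : Dec (Even (toℕ i)) → Sym (EvenStep s) i j
        by-parity (yes ev) = inj₁ (ev , Equivalence.from (StepTo⇔ s i j) (trans j≡ (flip-even (+ s) ev)))
        by-parity (no odd) = inj₂ (subst (λ k → Even (toℕ k)) (sym j≡′) (toℕ-fromℤ-even (odd-odd (odd⇒Oddℤ odd) (odd⇒Oddℤ odd-s)))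
                             , Equivalence.from (StepTo⇔ s j i) (sym (trans (cong (_⊕ + s) j≡′) (⊕-cancelʳ i (+ s)))))
          where
          j≡′ : j ≡ i ⊕ - + s
          j≡′ = trans j≡ (flip-odd (+ s) odd)

    Sym-OddStep⇔flip : ∀ {s} → Odd s → ∀ i j → Sym (OddStep s) i j ⇔ j ≡ flip (- + s) i
    Sym-OddStep⇔flip {s} odd-s i j = mk⇔ to from
      where
      flip-odd′ : ∀ {k} → Odd (toℕ k) → flip (- + s) k ≡ k ⊕ + s
      flip-odd′ odd = trans (flip-odd (- + s) odd) (cong (_ ⊕_) (ℤP.neg-involutive (+ s)))
      to : Sym (OddStep s) i j → j ≡ flip (- + s) i
      to (inj₁ (odd , st)) = trans (Equivalence.to (StepTo⇔ s i j) st) (sym (flip-odd′ odd))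
      to (inj₂ (odd , st)) = sym (begin
        flip (- + s) i           ≡⟨ cong (flip (- + s)) (Equivalence.to (StepTo⇔ s j i) st) ⟩
        flip (- + s) (j ⊕ + s)   ≡⟨ flip-even (- + s) (toℕ-fromℤ-even (odd+odd (odd⇒Oddℤ odd) (odd⇒Oddℤ odd-s))) ⟩
        j ⊕ + s ⊕ - + s          ≡⟨ ⊕-cancel j (+ s) ⟩
        j                        ∎)
        where open ≡-Reasoning
      from : j ≡ flip (- + s) i → Sym (OddStep s) i j
      from j≡ = by-parity (2 ℕDiv.∣? toℕ i)
        where
        by-parity : Dec (Even (toℕ i)) → Sym (OddStep s) i j
        by-parity (no odd) = inj₁ (odd , Equivalence.from (StepTo⇔ s i j) (trans j≡ (flip-odd′ odd)))
        by-parity (yes ev) = inj₂ (subst (λ k → Odd (toℕ k)) (sym j≡′) (toℕ-fromℤ-odd (even+odd (even⇒Evenℤ ev) (odd-neg (odd⇒Oddℤ odd-s))))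
                             , Equivalence.from (StepTo⇔ s j i) (sym (trans (cong (_⊕ + s) j≡′) (⊕-cancelʳ i (+ s)))))
          where
          j≡′ : j ≡ i ⊕ - + s
          j≡′ = trans j≡ (flip-even (- + s) ev)

  Sym-⇔ : ∀ {A : Set} {E F : A → A → Set} → (∀ p q → E p q ⇔ F p q) → ∀ p q → Sym E p q ⇔ Sym F p q
  Sym-⇔ E⇔F p q = E⇔F p q ⊎-⇔ E⇔F q p

  record Intertwines {A : Set} (f X Y : A → A) : Set where
    constructor intertwining
    field commutes : ∀ p → f (X p) ≡ Y (f p)

  open Intertwines

  Intertwines-∘ : ∀ {A : Set} {f g X Y Z : A → A} → Intertwines f X Y → Intertwines g Y Z → Intertwines (λ p → g (f p)) X Z
  Intertwines-∘ {g = g} f-XY g-YZ = intertwining (λ p → trans (cong g (commutes f-XY p)) (commutes g-YZ _))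

  module _ {A : Set} {f X Y : A → A} {E F : A → A → Set}
           (E⇔graph : ∀ p q → E p q ⇔ q ≡ X p) (F⇔graph : ∀ p q → F p q ⇔ q ≡ Y p) where

    mapsOnto⇒intertwines : MapsOnto f E F → Intertwines f X Y
    mapsOnto⇒intertwines f-EF = intertwining λ p →
      Equivalence.to (F⇔graph _ _) (proj₁ (f-EF p (X p)) (Equivalence.from (E⇔graph p (X p)) refl))

    intertwines⇒mapsOnto : (∀ {p q} → f p ≡ f q → p ≡ q) → Intertwines f X Y → MapsOnto f E F
    intertwines⇒mapsOnto f-injective f-XY p q =
      (λ e → Equivalence.from (F⇔graph _ _) (trans (cong f (Equivalence.to (E⇔graph p q) e)) (commutes f-XY p))) ,
      (λ e → Equivalence.from (E⇔graph p q) (f-injective (trans (Equivalence.to (F⇔graph _ _) e) (sym (commutes f-XY p)))))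

  pos-x²+x+1 : ∀ x → + (x ℕ.* x ℕ.+ x ℕ.+ 1) ≡ + x * + x + + x + 1ℤ
  pos-x²+x+1 x = trans (ℤP.pos-+ (x ℕ.* x ℕ.+ x) 1) (cong (_+ 1ℤ) (trans (ℤP.pos-+ (x ℕ.* x) x) (cong (_+ + x) (ℤP.pos-* x x))))

  pos-kx+r : ∀ k x r → + (k ℕ.* x ℕ.+ r) ≡ + k * + x + + r
  pos-kx+r k x r = trans (ℤP.pos-+ (k ℕ.* x) r) (cong (_+ + r) (ℤP.pos-* k x))

  ≡1-mod-4 : ∀ a → + 4 ∣ + a - 1ℤ → Σ ℕ λ a₀ → a ≡ 4 ℕ.* a₀ ℕ.+ 1
  ≡1-mod-4 zero 4∣-1 with ℕDiv.∣1⇒≡1 (∣⇒∣ᵤ 4∣-1)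
  ... | ()
  ≡1-mod-4 (suc a) 4∣a with ∣⇒∣ᵤ 4∣a
  ... | ℕDiv.divides a₀ a≡ = a₀ , trans (cong suc a≡) (trans (ℕP.+-comm 1 (a₀ ℕ.* 4)) (cong (ℕ._+ 1) (ℕP.*-comm a₀ 4)))

  ≡3-mod-4 : ∀ b → + 4 ∣ 1ℤ + + b → Σ ℕ λ b₀ → b ≡ 4 ℕ.* b₀ ℕ.+ 3
  ≡3-mod-4 b 4∣1+b with ∣⇒∣ᵤ 4∣1+b
  ... | ℕDiv.divides (suc b₀) 1+b≡ = b₀ , trans (ℕP.suc-injective 1+b≡) (trans (ℕP.+-comm 3 (b₀ ℕ.* 4)) (cong (ℕ._+ 3) (ℕP.*-comm b₀ 4)))

  <∸⇒+< : ∀ m n o → m ℕ.< n ∸ o → m ℕ.+ o ℕ.< n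
  <∸⇒+< m n zero h = subst (ℕ._< n) (sym (ℕP.+-identityʳ m)) h
  <∸⇒+< m (suc n) (suc o) h = subst (ℕ._< suc n) (sym (ℕP.+-suc m o)) (ℕ.s≤s (<∸⇒+< m n o h))

  +<⇒<∸ : ∀ m n o → m ℕ.+ o ℕ.< n → m ℕ.< n ∸ o
  +<⇒<∸ m n zero h = subst (ℕ._< n) (ℕP.+-identityʳ m) h
  +<⇒<∸ m (suc n) (suc o) h = +<⇒<∸ m n o (ℕP.≤-pred (subst (ℕ._< suc n) (ℕP.+-suc m o) h))

  divisor-of-double : ∀ {M e} → M ℕDiv.∣ 2 ℕ.* e → 0 ℕ.< e → e ℕ.< M → M ≡ 2 ℕ.* e
  divisor-of-double {M} {e} (ℕDiv.divides zero double≡0) 0<e _ = ⊥-elim (ℕP.<-irrefl (sym (ℕP.m+n≡0⇒m≡0 e double≡0)) 0<e)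
  divisor-of-double {M} {e} (ℕDiv.divides 1 double≡M) _ _ = sym (trans double≡M (ℕP.+-identityʳ M))
  divisor-of-double {M} {e} (ℕDiv.divides (suc (suc k)) double≡) _ e<M = ⊥-elim (ℕP.<-irrefl double≡ (ℕP.<-≤-trans (ℕP.*-monoʳ-< 2 e<M) double-M≤))
    where
    double-M≤ : 2 ℕ.* M ℕ.≤ suc (suc k) ℕ.* M
    double-M≤ = ℕP.*-monoˡ-≤ M {2} {suc (suc k)} (ℕ.s≤s (ℕ.s≤s ℕ.z≤n))

  rotation-identities : ∀ {d} A B {a b c} → a ≡ + 4 * A + 1ℤ → b ≡ + 4 * B + + 3 → c ≡ + 4 * A
    → d ∣ b + c * A - -1ℤ → d ∣ a + 1ℤ + c * B - (-1ℤ - 1ℤ) → d ∣ b + c * (1ℤ + B) - (a - b + a)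
    → (d ∣ + 4 * (A * A + B + 1ℤ)) × (d ∣ + 4 * (A * B + A + 1ℤ)) × (d ∣ + 8 * (B - A))
  rotation-identities A B refl refl refl d∣₁ d∣₂ d∣₃ = ∣-≡ d∣₁ (E₁ A B) , d∣E₂ , ∣-≡ (∣m∣n⇒∣m-n d∣₃ d∣E₂) (E₃ A B)
    where
    E₁ : ∀ A B → + 4 * B + + 3 + + 4 * A * A - -1ℤ ≡ + 4 * (A * A + B + 1ℤ)
    E₁ = solve-∀
    E₂ : ∀ A B → + 4 * A + 1ℤ + 1ℤ + + 4 * A * B - (-1ℤ - 1ℤ) ≡ + 4 * (A * B + A + 1ℤ)
    E₂ = solve-∀
    E₃ : ∀ A B → + 4 * B + + 3 + + 4 * A * (1ℤ + B) - (+ 4 * A + 1ℤ - (+ 4 * B + + 3) + (+ 4 * A + 1ℤ))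
               - + 4 * (A * B + A + 1ℤ) ≡ + 8 * (B - A)
    E₃ = solve-∀
    d∣E₂ = ∣-≡ d∣₂ (E₂ A B)

  -- E₁, E₂, E₃ say that the images of v_a, v_b and v_{b+2} computed along the colours agree
  -- with the translates of the images of v₁, v₃ and v₁.
  record RotationCongruences (n a b : ℕ) : Set where
    field
      a₀ b₀ : ℕ
      4∣n : 4 ℕDiv.∣ n
      a≡ : a ≡ 4 ℕ.* a₀ ℕ.+ 1
      b≡ : b ≡ 4 ℕ.* b₀ ℕ.+ 3
      n∣E₁ : + n ∣ + 4 * (+ a₀ * + a₀ + + b₀ + 1ℤ)
      n∣E₂ : + n ∣ + 4 * (+ a₀ * + b₀ + + a₀ + 1ℤ)
      n∣E₃ : + n ∣ + 8 * (+ b₀ - + a₀)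

  -- The graph and its colour rotations

  module Graph (n : ℕ) {{n≢0 : NonZero n}} (n-even : Even n) (a b : ℕ) (a-odd : Odd a) (b-odd : Odd b)
               (x≡a : CondA n a b) where

    open Modular n public
    open Parity n n-even public

    R B G : Vert n → Vert n
    R (U , i) = V , i
    R (V , i) = U , i
    B (U , i) = U , flip 1ℤ i
    B (V , i) = V , flip (+ a) i
    G (U , i) = U , flip -1ℤ i
    G (V , i) = V , flip (+ b) i

    G-involutive : ∀ p → G (G p) ≡ p
    G-involutive (U , i) = cong (U ,_) (flip-involutive (oddℤ (divides 0ℤ refl)) i)
    G-involutive (V , i) = cong (V ,_) (flip-involutive (odd⇒Oddℤ b-odd) i)

    pair⇔ : ∀ {s} {j k : Fin n} → j ≡ k ⇔ _≡_ {A = Vert n} (s , j) (s , k)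
    pair⇔ {s} = mk⇔ (cong (s ,_)) (cong proj₂)

    VX⇔VStep : ∀ i j → VX n a b i j ⇔ VStep n a i j
    VX⇔VStep i j = mk⇔ (λ { (inj₁ (_ , st)) → st ; (inj₂ (x≢a , _)) → ⊥-elim (x≢a x≡a) }) (λ st → inj₁ (x≡a , st))

    VY⇔VStep : ∀ i j → VY n a b i j ⇔ VStep n b i j
    VY⇔VStep i j = mk⇔ (λ { (inj₁ (_ , st)) → st ; (inj₂ (x≢a , _)) → ⊥-elim (x≢a x≡a) }) (λ st → inj₁ (x≡a , st))

    InR⇔graph : ∀ p q → InR n a b p q ⇔ q ≡ R p
    InR⇔graph (U , i) (U , j) = mk⇔ (λ { (inj₁ ()) ; (inj₂ ()) }) (λ ())
    InR⇔graph (U , i) (V , j) = mk⇔ (λ { (inj₁ refl) → refl ; (inj₂ ()) }) (λ { refl → inj₁ refl })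
    InR⇔graph (V , i) (U , j) = mk⇔ (λ { (inj₁ ()) ; (inj₂ refl) → refl }) (λ { refl → inj₂ refl })
    InR⇔graph (V , i) (V , j) = mk⇔ (λ { (inj₁ ()) ; (inj₂ ()) }) (λ ())

    InB⇔graph : ∀ p q → InB n a b p q ⇔ q ≡ B p
    InB⇔graph (U , i) (U , j) = ⇔.trans (Sym-EvenStep⇔flip 1-odd i j) pair⇔
    InB⇔graph (U , i) (V , j) = mk⇔ (λ { (inj₁ ()) ; (inj₂ ()) }) (λ ())
    InB⇔graph (V , i) (U , j) = mk⇔ (λ { (inj₁ ()) ; (inj₂ ()) }) (λ ())
    InB⇔graph (V , i) (V , j) = ⇔.trans (Sym-⇔ VX⇔VStep i j) (⇔.trans (Sym-EvenStep⇔flip a-odd i j) pair⇔)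

    InG⇔graph : ∀ p q → InG n a b p q ⇔ q ≡ G p
    InG⇔graph (U , i) (U , j) = ⇔.trans (Sym-OddStep⇔flip 1-odd i j) pair⇔
    InG⇔graph (U , i) (V , j) = mk⇔ (λ { (inj₁ ()) ; (inj₂ ()) }) (λ ())
    InG⇔graph (V , i) (U , j) = mk⇔ (λ { (inj₁ ()) ; (inj₂ ()) }) (λ ())
    InG⇔graph (V , i) (V , j) = ⇔.trans (Sym-⇔ VY⇔VStep i j) (⇔.trans (Sym-EvenStep⇔flip b-odd i j) pair⇔)

    Adj⇔coloured : ∀ p q → Adj n a b p q ⇔ (InR n a b p q ⊎ InB n a b p q ⊎ InG n a b p q)
    Adj⇔coloured (U , i) (U , j) = mk⇔ to from
      where
      to : Adj n a b (U , i) (U , j) → _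
      to (inj₁ st) with 2 ℕDiv.∣? toℕ i
      ... | yes ev = inj₂ (inj₁ (inj₁ (ev , st)))
      ... | no odd = inj₂ (inj₂ (inj₁ (odd , st)))
      to (inj₂ st) with 2 ℕDiv.∣? toℕ j
      ... | yes ev = inj₂ (inj₁ (inj₂ (ev , st)))
      ... | no odd = inj₂ (inj₂ (inj₂ (odd , st)))
      from : _ → Adj n a b (U , i) (U , j)
      from (inj₁ (inj₁ ()))
      from (inj₁ (inj₂ ()))
      from (inj₂ (inj₁ (inj₁ (_ , st)))) = inj₁ st
      from (inj₂ (inj₁ (inj₂ (_ , st)))) = inj₂ st
      from (inj₂ (inj₂ (inj₁ (_ , st)))) = inj₁ st
      from (inj₂ (inj₂ (inj₂ (_ , st)))) = inj₂ st
    Adj⇔coloured (U , i) (V , j) = mk⇔ inj₁ λ { (inj₁ e) → e ; (inj₂ (inj₁ (inj₁ ()))) ; (inj₂ (inj₁ (inj₂ ())))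
                                              ; (inj₂ (inj₂ (inj₁ ()))) ; (inj₂ (inj₂ (inj₂ ()))) }
    Adj⇔coloured (V , i) (U , j) = mk⇔ inj₁ λ { (inj₁ e) → e ; (inj₂ (inj₁ (inj₁ ()))) ; (inj₂ (inj₁ (inj₂ ())))
                                              ; (inj₂ (inj₂ (inj₁ ()))) ; (inj₂ (inj₂ (inj₂ ()))) }
    Adj⇔coloured (V , i) (V , j) = mk⇔ to from
      where
      to : Adj n a b (V , i) (V , j) → _
      to (inj₁ (inj₁ st)) = inj₂ (inj₁ (inj₁ (inj₁ (x≡a , st))))
      to (inj₁ (inj₂ st)) = inj₂ (inj₂ (inj₁ (inj₁ (x≡a , st))))
      to (inj₂ (inj₁ st)) = inj₂ (inj₁ (inj₂ (inj₁ (x≡a , st))))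
      to (inj₂ (inj₂ st)) = inj₂ (inj₂ (inj₂ (inj₁ (x≡a , st))))
      from : _ → Adj n a b (V , i) (V , j)
      from (inj₁ (inj₁ ()))
      from (inj₁ (inj₂ ()))
      from (inj₂ (inj₁ (inj₁ e))) = inj₁ (inj₁ (Equivalence.to (VX⇔VStep i j) e))
      from (inj₂ (inj₁ (inj₂ e))) = inj₂ (inj₁ (Equivalence.to (VX⇔VStep j i) e))
      from (inj₂ (inj₂ (inj₁ e))) = inj₁ (inj₂ (Equivalence.to (VY⇔VStep i j) e))
      from (inj₂ (inj₂ (inj₂ e))) = inj₂ (inj₂ (Equivalence.to (VY⇔VStep j i) e))

    Adj⇔neighbour : ∀ p q → Adj n a b p q ⇔ (q ≡ R p ⊎ q ≡ B p ⊎ q ≡ G p)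
    Adj⇔neighbour p q = ⇔.trans (Adj⇔coloured p q) (InR⇔graph p q ⊎-⇔ InB⇔graph p q ⊎-⇔ InG⇔graph p q)

    infix 10 _⟨_⟩
    _⟨_⟩ : Side → ℤ → Vert n
    s ⟨ z ⟩ = s , fromℤ z

    u₀ : Vert n
    u₀ = U ⟨ 0ℤ ⟩

    toℕ-u₀ : toℕ (fromℤ 0ℤ) ≡ 0
    toℕ-u₀ = toℕ-fromℤ (ℕ.>-nonZero⁻¹ n)

    ⟨⟩-≈ : ∀ s {x y} → x ≈ y → s ⟨ x ⟩ ≡ s ⟨ y ⟩
    ⟨⟩-≈ s x≈y = cong (s ,_) (fromℤ-cong x≈y)

    B-U-even : ∀ {z} → Evenℤ z → B (U ⟨ z ⟩) ≡ U ⟨ z + 1ℤ ⟩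
    B-U-even 2∣z = cong (U ,_) (flip-fromℤ-even 1ℤ 2∣z)

    B-U-odd : ∀ {z} → Oddℤ z → B (U ⟨ z ⟩) ≡ U ⟨ z - 1ℤ ⟩
    B-U-odd 2∣1+z = cong (U ,_) (flip-fromℤ-odd 1ℤ 2∣1+z)

    G-U-even : ∀ {z} → Evenℤ z → G (U ⟨ z ⟩) ≡ U ⟨ z - 1ℤ ⟩
    G-U-even 2∣z = cong (U ,_) (flip-fromℤ-even -1ℤ 2∣z)

    G-U-odd : ∀ {z} → Oddℤ z → G (U ⟨ z ⟩) ≡ U ⟨ z + 1ℤ ⟩
    G-U-odd 2∣1+z = cong (U ,_) (flip-fromℤ-odd -1ℤ 2∣1+z)

    B-V-even : ∀ {z} → Evenℤ z → B (V ⟨ z ⟩) ≡ V ⟨ z + + a ⟩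
    B-V-even 2∣z = cong (V ,_) (flip-fromℤ-even (+ a) 2∣z)

    B-V-odd : ∀ {z} → Oddℤ z → B (V ⟨ z ⟩) ≡ V ⟨ z - + a ⟩
    B-V-odd 2∣1+z = cong (V ,_) (flip-fromℤ-odd (+ a) 2∣1+z)

    G-V-even : ∀ {z} → Evenℤ z → G (V ⟨ z ⟩) ≡ V ⟨ z + + b ⟩
    G-V-even 2∣z = cong (V ,_) (flip-fromℤ-even (+ b) 2∣z)

    G-V-odd : ∀ {z} → Oddℤ z → G (V ⟨ z ⟩) ≡ V ⟨ z - + b ⟩
    G-V-odd 2∣1+z = cong (V ,_) (flip-fromℤ-odd (+ b) 2∣1+z)

    shift : ℤ → Vert n → Vert n
    shift e (s , i) = s , i ⊕ e

    shift-⟨⟩ : ∀ e s z → shift e (s ⟨ z ⟩) ≡ s ⟨ z + e ⟩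
    shift-⟨⟩ e s z = cong (s ,_) (fromℤ-⊕ z e)

    shift-zero : ∀ p → shift 0ℤ p ≡ p
    shift-zero (s , i) = cong (s ,_) (trans (cong fromℤ (ℤP.+-identityʳ (+ toℕ i))) (fromℤ-toℕ i))

    shift-shift : ∀ e e′ p → shift e (shift e′ p) ≡ shift (e′ + e) p
    shift-shift e e′ (s , i) = cong (s ,_) (⊕-⊕ i e′ e)

    shift-R : ∀ e → Intertwines (shift e) R R
    shift-R e = intertwining λ { (U , i) → refl ; (V , i) → refl }

    shift-B : ∀ {e} → Evenℤ e → Intertwines (shift e) B B
    shift-B 2∣e = intertwining λ { (U , i) → cong (U ,_) (sym (flip-⊕ 1ℤ 2∣e i))
                                  ; (V , i) → cong (V ,_) (sym (flip-⊕ (+ a) 2∣e i)) }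

    shift-G : ∀ {e} → Evenℤ e → Intertwines (shift e) G G
    shift-G 2∣e = intertwining λ { (U , i) → cong (U ,_) (sym (flip-⊕ -1ℤ 2∣e i))
                                  ; (V , i) → cong (V ,_) (sym (flip-⊕ (+ b) 2∣e i)) }

    Recolours : (f R′ B′ G′ : Vert n → Vert n) → Set
    Recolours f R′ B′ G′ = Intertwines f R R′ × Intertwines f B B′ × Intertwines f G G′

    U-successor : ∀ k → U ⟨ + suc k ⟩ ≡ B (U ⟨ + k ⟩) ⊎ U ⟨ + suc k ⟩ ≡ G (U ⟨ + k ⟩)
    U-successor k with 2 ℕDiv.∣? k
    ... | yes ev = inj₁ (sym (trans (B-U-even (even⇒Evenℤ ev)) (cong (U ⟨_⟩) (cong +_ (ℕP.+-comm k 1)))))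
    ... | no odd = inj₂ (sym (trans (G-U-odd (odd⇒Oddℤ odd)) (cong (U ⟨_⟩) (cong +_ (ℕP.+-comm k 1)))))

    rigidity : ∀ {f g R′ B′ G′} → Recolours f R′ B′ G′ → Recolours g R′ B′ G′ → f u₀ ≡ g u₀ → ∀ p → f p ≡ g p
    rigidity {f} {g} (f-R , f-B , f-G) (g-R , g-B , g-G) f≡g₀ = agree
      where
      along : ∀ {X X′ p} → Intertwines f X X′ → Intertwines g X X′ → f p ≡ g p → f (X p) ≡ g (X p)
      along {X′ = X′} f-X g-X e = trans (commutes f-X _) (trans (cong X′ e) (sym (commutes g-X _)))
      on-U : ∀ k → f (U ⟨ + k ⟩) ≡ g (U ⟨ + k ⟩)
      on-U zero = f≡g₀
      on-U (suc k) with U-successor k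
      ... | inj₁ e = subst (λ p → f p ≡ g p) (sym e) (along f-B g-B (on-U k))
      ... | inj₂ e = subst (λ p → f p ≡ g p) (sym e) (along f-G g-G (on-U k))
      agree : ∀ p → f p ≡ g p
      agree (U , i) = subst (λ j → f (U , j) ≡ g (U , j)) (fromℤ-toℕ i) (on-U (toℕ i))
      agree (V , i) = along {p = U , i} f-R g-R (agree (U , i))

    Rotation : (Vert n → Vert n) → Set
    Rotation σ = Recolours σ G R B

    rotation-cube : ∀ {σ} → Rotation σ → σ u₀ ≡ u₀ → ∀ p → σ (σ (σ p)) ≡ p
    rotation-cube {σ} (σ-R , σ-B , σ-G) σu₀ = rigidity cube-recolours identity-recolours cube-u₀
      where
      cube-recolours : Recolours (λ p → σ (σ (σ p))) R B G
      cube-recolours = Intertwines-∘ (Intertwines-∘ σ-R σ-G) σ-B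
                     , Intertwines-∘ (Intertwines-∘ σ-B σ-R) σ-G
                     , Intertwines-∘ (Intertwines-∘ σ-G σ-B) σ-R
      identity-recolours : Recolours (λ p → p) R B G
      identity-recolours = intertwining (λ _ → refl) , intertwining (λ _ → refl) , intertwining (λ _ → refl)
      cube-u₀ : σ (σ (σ u₀)) ≡ u₀
      cube-u₀ = trans (cong (λ p → σ (σ p)) σu₀) (trans (cong σ σu₀) σu₀)

    rotation⇒automorphism : ∀ {σ} → Rotation σ → σ u₀ ≡ u₀ → IsAutomorphism n a b σ
    rotation⇒automorphism {σ} rot@(σ-R , σ-B , σ-G) σu₀ = bijective , preserves-adjacency
      where
      cube = rotation-cube rot σu₀
      bijective : Bijective _≡_ _≡_ σ
      bijective = inverseᵇ⇒bijective (strictlyInverseˡ⇒inverseˡ σ cube , strictlyInverseʳ⇒inverseʳ σ cube)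
      injective : ∀ {p q} → σ p ≡ σ q → p ≡ q
      injective = proj₁ bijective
      preserves-adjacency : MapsOnto σ (Adj n a b) (Adj n a b)
      preserves-adjacency p q = (λ adj → Equivalence.from (Adj⇔neighbour _ _) (forth (Equivalence.to (Adj⇔neighbour p q) adj)))
                              , (λ adj → Equivalence.from (Adj⇔neighbour p q) (back (Equivalence.to (Adj⇔neighbour _ _) adj)))
        where
        forth : q ≡ R p ⊎ q ≡ B p ⊎ q ≡ G p → σ q ≡ R (σ p) ⊎ σ q ≡ B (σ p) ⊎ σ q ≡ G (σ p)
        forth (inj₁ refl) = inj₂ (inj₂ (commutes σ-R p))
        forth (inj₂ (inj₁ refl)) = inj₁ (commutes σ-B p)
        forth (inj₂ (inj₂ refl)) = inj₂ (inj₁ (commutes σ-G p))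
        back : σ q ≡ R (σ p) ⊎ σ q ≡ B (σ p) ⊎ σ q ≡ G (σ p) → q ≡ R p ⊎ q ≡ B p ⊎ q ≡ G p
        back (inj₁ e) = inj₂ (inj₁ (injective (trans e (sym (commutes σ-B p)))))
        back (inj₂ (inj₁ e)) = inj₂ (inj₂ (injective (trans e (sym (commutes σ-G p)))))
        back (inj₂ (inj₂ e)) = inj₁ (injective (trans e (sym (commutes σ-R p))))

    fixes-u₀⇔ : ∀ σ → FixesU0 n σ ⇔ σ u₀ ≡ u₀
    fixes-u₀⇔ σ = mk⇔ (λ fix → fix (fromℤ 0ℤ) toℕ-u₀)
                      (λ σu₀ i i≡0 → subst (λ j → σ (U , j) ≡ (U , j)) (FinP.toℕ-injective (trans toℕ-u₀ (sym i≡0))) σu₀)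

    colour-rotating-automorphism⇔rotation :
      Σ (Vert n → Vert n) (λ σ → IsAutomorphism n a b σ × FixesU0 n σ × CyclicRBG n a b σ)
      ⇔ Σ (Vert n → Vert n) (λ σ → Rotation σ × σ u₀ ≡ u₀)
    colour-rotating-automorphism⇔rotation = mk⇔ to from
      where
      to : _ → _
      to (σ , _ , fix , inj₂ (R→G , G→B , B→R)) =
        σ , (mapsOnto⇒intertwines InR⇔graph InG⇔graph R→G , mapsOnto⇒intertwines InB⇔graph InR⇔graph B→R
            , mapsOnto⇒intertwines InG⇔graph InB⇔graph G→B) , Equivalence.to (fixes-u₀⇔ σ) fix
      to (σ , _ , fix , inj₁ (R→B , B→G , G→R)) =
        (λ p → σ (σ p)) , (Intertwines-∘ σ-R σ-B , Intertwines-∘ σ-B σ-G , Intertwines-∘ σ-G σ-R) ,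
        trans (cong σ σu₀) σu₀
        where
        σ-R = mapsOnto⇒intertwines InR⇔graph InB⇔graph R→B
        σ-B = mapsOnto⇒intertwines InB⇔graph InG⇔graph B→G
        σ-G = mapsOnto⇒intertwines InG⇔graph InR⇔graph G→R
        σu₀ = Equivalence.to (fixes-u₀⇔ σ) fix
      from : _ → _
      from (σ , rot@(σ-R , σ-B , σ-G) , σu₀) =
        σ , aut , Equivalence.from (fixes-u₀⇔ σ) σu₀ ,
        inj₂ (intertwines⇒mapsOnto InR⇔graph InG⇔graph injective σ-R
             , intertwines⇒mapsOnto InG⇔graph InB⇔graph injective σ-G
             , intertwines⇒mapsOnto InB⇔graph InR⇔graph injective σ-B)
        where
        aut = rotation⇒automorphism rot σu₀
        injective = proj₁ (proj₁ aut)

    module FromRotation (τ : Vert n → Vert n) (τ-rotation : Rotation τ) (τ-u₀ : τ u₀ ≡ u₀) where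

      c : ℤ
      c = + a - 1ℤ

      τ-R : Intertwines τ R G
      τ-R = proj₁ τ-rotation

      τ-B : Intertwines τ B R
      τ-B = proj₁ (proj₂ τ-rotation)

      τ-G : Intertwines τ G B
      τ-G = proj₂ (proj₂ τ-rotation)

      τ-u₁ : τ (U ⟨ + 1 ⟩) ≡ V ⟨ 0ℤ ⟩
      τ-u₁ = trans (cong τ (sym (B-U-even (evenℤ (divides 0ℤ refl))))) (trans (commutes τ-B u₀) (cong R τ-u₀))

      τ-u₂ : τ (U ⟨ + 2 ⟩) ≡ V ⟨ + a ⟩
      τ-u₂ = trans (cong τ (sym (G-U-odd (oddℤ ∣-refl)))) (trans (commutes τ-G _) (trans (cong B τ-u₁) (B-V-even (evenℤ (divides 0ℤ refl)))))

      τ-u₃ : τ (U ⟨ + 3 ⟩) ≡ U ⟨ + a ⟩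
      τ-u₃ = trans (cong τ (sym (B-U-even (evenℤ (divides 1ℤ refl))))) (trans (commutes τ-B _) (cong R τ-u₂))

      τ-u₄ : τ (U ⟨ + 4 ⟩) ≡ U ⟨ c ⟩
      τ-u₄ = trans (cong τ (sym (G-U-odd (oddℤ (divides (+ 2) refl))))) (trans (commutes τ-G _) (trans (cong B τ-u₃) (B-U-odd (odd⇒Oddℤ a-odd))))

      τ-v₀ : τ (V ⟨ 0ℤ ⟩) ≡ U ⟨ -1ℤ ⟩
      τ-v₀ = trans (commutes τ-R u₀) (trans (cong G τ-u₀) (G-U-even (evenℤ (divides 0ℤ refl))))

      τ-v₁ : τ (V ⟨ + 1 ⟩) ≡ V ⟨ + b ⟩
      τ-v₁ = trans (commutes τ-R _) (trans (cong G τ-u₁) (G-V-even (evenℤ (divides 0ℤ refl))))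

      τ-v₂ : τ (V ⟨ + 2 ⟩) ≡ V ⟨ + a - + b ⟩
      τ-v₂ = trans (commutes τ-R _) (trans (cong G τ-u₂) (G-V-odd (odd⇒Oddℤ a-odd)))

      τ-v₃ : τ (V ⟨ + 3 ⟩) ≡ U ⟨ + a + 1ℤ ⟩
      τ-v₃ = trans (commutes τ-R _) (trans (cong G τ-u₃) (G-U-odd (odd⇒Oddℤ a-odd)))

      τ-vₐ : τ (V ⟨ + a ⟩) ≡ V ⟨ -1ℤ ⟩
      τ-vₐ = trans (cong τ (sym (B-V-even (evenℤ (divides 0ℤ refl))))) (trans (commutes τ-B _) (cong R τ-v₀))

      τ-v_b : τ (V ⟨ + b ⟩) ≡ U ⟨ -1ℤ - 1ℤ ⟩
      τ-v_b = trans (cong τ (sym (G-V-even (evenℤ (divides 0ℤ refl)))))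
                    (trans (commutes τ-G _) (trans (cong B τ-v₀) (B-U-odd (oddℤ (divides 0ℤ refl)))))

      τ-v_b+2 : τ (V ⟨ + 2 + + b ⟩) ≡ V ⟨ + a - + b + + a ⟩
      τ-v_b+2 = trans (cong τ (sym (G-V-even (evenℤ (divides 1ℤ refl)))))
                      (trans (commutes τ-G _) (trans (cong B τ-v₂) (B-V-even (odd-odd (odd⇒Oddℤ a-odd) (odd⇒Oddℤ b-odd)))))

      c-even : Evenℤ c
      c-even = odd⇒pred-even (odd⇒Oddℤ a-odd)

      τ-shift₄ : ∀ p → τ (shift (+ 4) p) ≡ shift c (τ p)
      τ-shift₄ = rigidity
        (Intertwines-∘ (shift-R (+ 4)) τ-R , Intertwines-∘ (shift-B (evenℤ (divides (+ 2) refl))) τ-B , Intertwines-∘ (shift-G (evenℤ (divides (+ 2) refl))) τ-G)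
        (Intertwines-∘ τ-R (shift-G c-even) , Intertwines-∘ τ-B (shift-R c) , Intertwines-∘ τ-G (shift-B c-even))
        (begin
          τ (shift (+ 4) u₀)   ≡⟨ cong τ (shift-⟨⟩ (+ 4) U 0ℤ) ⟩
          τ (U ⟨ + 4 ⟩)        ≡⟨ τ-u₄ ⟩
          U ⟨ c ⟩              ≡⟨ cong (U ⟨_⟩) (ℤP.+-identityˡ c) ⟨
          U ⟨ 0ℤ + c ⟩         ≡⟨ shift-⟨⟩ c U 0ℤ ⟨
          shift c u₀           ≡⟨ cong (shift c) τ-u₀ ⟨
          shift c (τ u₀)       ∎)
        where open ≡-Reasoning

      τ-shift : ∀ m p → τ (shift (+ 4 * + m) p) ≡ shift (c * + m) (τ p)
      τ-shift zero p = trans (cong τ (shift-zero p)) (sym (trans (cong (λ e → shift e (τ p)) (ℤP.*-zeroʳ c)) (shift-zero (τ p))))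
      τ-shift (suc m) p = begin
        τ (shift (+ 4 * + suc m) p)              ≡⟨ cong (λ e → τ (shift e p)) (split4 (+ m)) ⟩
        τ (shift (+ 4 * + m + + 4) p)            ≡⟨ cong τ (shift-shift (+ 4) (+ 4 * + m) p) ⟨
        τ (shift (+ 4) (shift (+ 4 * + m) p))    ≡⟨ τ-shift₄ _ ⟩
        shift c (τ (shift (+ 4 * + m) p))        ≡⟨ cong (shift c) (τ-shift m p) ⟩
        shift c (shift (c * + m) (τ p))          ≡⟨ shift-shift c (c * + m) (τ p) ⟩
        shift (c * + m + c) (τ p)                ≡⟨ cong (λ e → shift e (τ p)) (splitc c (+ m)) ⟨
        shift (c * + suc m) (τ p)                ∎
        where
        open ≡-Reasoning
        split4 : ∀ x → + 4 * (1ℤ + x) ≡ + 4 * x + + 4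
        split4 = solve-∀
        splitc : ∀ c x → c * (1ℤ + x) ≡ c * x + c
        splitc = solve-∀

      τ-translated : ∀ m s z {s′ y x} → τ (s ⟨ z ⟩) ≡ s′ ⟨ y ⟩ → τ (s ⟨ z + + 4 * + m ⟩) ≡ s′ ⟨ x ⟩ → y + c * + m ≈ x
      τ-translated m s z {s′} {y} {x} τ-base τ-translate = fromℤ-injective (cong proj₂ (begin
        s′ ⟨ y + c * + m ⟩               ≡⟨ shift-⟨⟩ (c * + m) s′ y ⟨
        shift (c * + m) (s′ ⟨ y ⟩)        ≡⟨ cong (shift (c * + m)) τ-base ⟨
        shift (c * + m) (τ (s ⟨ z ⟩))     ≡⟨ τ-shift m (s ⟨ z ⟩) ⟨
        τ (shift (+ 4 * + m) (s ⟨ z ⟩))   ≡⟨ cong τ (shift-⟨⟩ (+ 4 * + m) s z) ⟩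
        τ (s ⟨ z + + 4 * + m ⟩)          ≡⟨ τ-translate ⟩
        s′ ⟨ x ⟩                         ∎))
        where open ≡-Reasoning

      4∤n+2 : ¬ 4 ℕDiv.∣ n ℕ.+ 2
      4∤n+2 (ℕDiv.divides k n+2≡k*4) = U≢V (cong proj₁ (begin
        shift (c * + k) u₀                 ≡⟨ cong (shift (c * + k)) τ-u₀ ⟨
        shift (c * + k) (τ u₀)             ≡⟨ τ-shift k u₀ ⟨
        τ (shift (+ 4 * + k) u₀)           ≡⟨ cong τ (shift-⟨⟩ (+ 4 * + k) U 0ℤ) ⟩
        τ (U ⟨ 0ℤ + + 4 * + k ⟩)           ≡⟨ cong (λ i → τ (U , i)) (fromℤ-cong 4k≈2) ⟩
        τ (U ⟨ + 2 ⟩)                      ≡⟨ τ-u₂ ⟩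
        V ⟨ + a ⟩                          ∎))
        where
        open ≡-Reasoning
        U≢V : U ≢ V
        U≢V ()
        n+2 : + n + + 2 ≡ + k * + 4
        n+2 = trans (sym (ℤP.pos-+ n 2)) (trans (cong +_ n+2≡k*4) (ℤP.pos-* k 4))
        4k≈2 : 0ℤ + + 4 * + k ≈ + 2
        4k≈2 = ≈-by (∣-refl {+ n}) (trans (regroup (+ k)) (trans (cong (_- + 2) (sym n+2)) (cancel (+ n))))
          where
          regroup : ∀ k → 0ℤ + + 4 * k - + 2 ≡ k * + 4 - + 2
          regroup = solve-∀
          cancel : ∀ m → m + + 2 - + 2 ≡ m
          cancel = solve-∀

      4∣n : 4 ℕDiv.∣ n
      4∣n = halve n-even
        where
        halve : Even n → 4 ℕDiv.∣ n
        halve (ℕDiv.divides h n≡h*2) with 2 ℕDiv.∣? h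
        ... | yes 2∣h = subst (4 ℕDiv.∣_) (sym n≡h*2) (ℕDiv.*-monoˡ-∣ 2 2∣h)
        ... | no h-odd = ⊥-elim (4∤n+2 (subst (4 ℕDiv.∣_) h+1*2≡n+2 (ℕDiv.*-monoˡ-∣ 2 (odd⇒suc-even h h-odd))))
          where
          h+1*2≡n+2 : suc h ℕ.* 2 ≡ n ℕ.+ 2
          h+1*2≡n+2 = trans (ℕP.+-comm 2 (h ℕ.* 2)) (cong (ℕ._+ 2) (sym n≡h*2))

      4∣c : + 4 ∣ c
      4∣c with 4∣n
      ... | ℕDiv.divides zero n≡0 = ⊥-elim (ℕ.≢-nonZero⁻¹ n n≡0)
      ... | ℕDiv.divides (suc m) n≡M*4 = *-cancelʳ-∣ (+ M) (subst (_∣ c * + M) n≡4M n∣cM)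
        where
        M = suc m
        n≡4M : + n ≡ + 4 * + M
        n≡4M = trans (cong +_ n≡M*4) (trans (ℤP.pos-* M 4) (ℤP.*-comm (+ M) (+ 4)))
        0+x-0 : ∀ x → 0ℤ + x - 0ℤ ≡ x
        0+x-0 x = trans (ℤP.+-identityʳ (0ℤ + x)) (ℤP.+-identityˡ x)
        n∣cM : + n ∣ c * + M
        n∣cM = ∣-≡ (_≈_.∣-diff (τ-translated M U 0ℤ τ-u₀ (trans (cong (λ i → τ (U , i)) (fromℤ-cong 4M≈0)) τ-u₀))) (0+x-0 (c * + M))
          where
          4M≈0 : 0ℤ + + 4 * + M ≈ 0ℤ
          4M≈0 = ≈-by (∣-refl {+ n}) (trans (0+x-0 _) (sym n≡4M))

      -- opaque, so that conversion checking never evaluates the proofs producing a₀ and b₀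
      opaque
        a₀ : ℕ
        a₀ = proj₁ (≡1-mod-4 a 4∣c)

        a≡ : a ≡ 4 ℕ.* a₀ ℕ.+ 1
        a≡ = proj₂ (≡1-mod-4 a 4∣c)

      a≡ℤ : + a ≡ + 4 * + a₀ + 1ℤ
      a≡ℤ = trans (cong +_ a≡) (pos-kx+r 4 a₀ 1)

      c≡ : c ≡ + 4 * + a₀
      c≡ = trans (cong (_- 1ℤ) a≡ℤ) (cancel (+ 4 * + a₀))
        where
        cancel : ∀ x → x + 1ℤ - 1ℤ ≡ x
        cancel = solve-∀

      b+ca₀≈-1 : + b + c * + a₀ ≈ -1ℤ
      b+ca₀≈-1 = τ-translated a₀ V (+ 1) τ-v₁ (subst (λ z → τ (V ⟨ z ⟩) ≡ V ⟨ -1ℤ ⟩) (trans a≡ℤ (ℤP.+-comm (+ 4 * + a₀) 1ℤ)) τ-vₐ)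

      4∣1+b : + 4 ∣ 1ℤ + + b
      4∣1+b = ∣-≡ (∣m∣n⇒∣m-n (∣-trans (∣ᵤ⇒∣ 4∣n) (_≈_.∣-diff b+ca₀≈-1)) (∣m⇒∣m*n (+ a₀) 4∣c)) (regroup (+ b) c (+ a₀))
        where
        regroup : ∀ b c a₀ → (b + c * a₀ - -1ℤ) - c * a₀ ≡ 1ℤ + b
        regroup = solve-∀

      opaque
        b₀ : ℕ
        b₀ = proj₁ (≡3-mod-4 b 4∣1+b)

        b≡ : b ≡ 4 ℕ.* b₀ ℕ.+ 3
        b≡ = proj₂ (≡3-mod-4 b 4∣1+b)

      b≡ℤ : + b ≡ + 4 * + b₀ + + 3
      b≡ℤ = trans (cong +_ b≡) (pos-kx+r 4 b₀ 3)

      a+1+cb₀≈-2 : + a + 1ℤ + c * + b₀ ≈ -1ℤ - 1ℤ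
      a+1+cb₀≈-2 = τ-translated b₀ V (+ 3) τ-v₃ (subst (λ z → τ (V ⟨ z ⟩) ≡ U ⟨ -1ℤ - 1ℤ ⟩) (trans b≡ℤ (ℤP.+-comm (+ 4 * + b₀) (+ 3))) τ-v_b)

      b+cb₀+c≈2a-b : + b + c * + suc b₀ ≈ + a - + b + + a
      b+cb₀+c≈2a-b = τ-translated (suc b₀) V (+ 1) τ-v₁ (subst (λ z → τ (V ⟨ z ⟩) ≡ V ⟨ + a - + b + + a ⟩) 2+b≡ τ-v_b+2)
        where
        regroup : ∀ b₀ → + 2 + (+ 4 * b₀ + + 3) ≡ + 1 + + 4 * (1ℤ + b₀)
        regroup = solve-∀
        2+b≡ : + 2 + + b ≡ + 1 + + 4 * + suc b₀
        2+b≡ = trans (cong (λ β → + 2 + β) b≡ℤ) (regroup (+ b₀))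

      congruences : RotationCongruences n a b
      congruences = record { a₀ = a₀ ; b₀ = b₀ ; 4∣n = 4∣n ; a≡ = a≡ ; b≡ = b≡
                           ; n∣E₁ = proj₁ E ; n∣E₂ = proj₁ (proj₂ E) ; n∣E₃ = proj₂ (proj₂ E) }
        where
        E = rotation-identities (+ a₀) (+ b₀) a≡ℤ b≡ℤ c≡
              (_≈_.∣-diff b+ca₀≈-1) (_≈_.∣-diff a+1+cb₀≈-2) (_≈_.∣-diff b+cb₀+c≈2a-b)

    module FromCongruences (rc : RotationCongruences n a b) where

      open RotationCongruences rc

      A B₀ α β c : ℤ
      A = + a₀
      B₀ = + b₀
      α = + 4 * A + 1ℤ
      β = + 4 * B₀ + + 3
      c = + 4 * A

      a≡α : + a ≡ α
      a≡α = trans (cong +_ a≡) (pos-kx+r 4 a₀ 1)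

      b≡β : + b ≡ β
      b≡β = trans (cong +_ b≡) (pos-kx+r 4 b₀ 3)

      -- the images of u_r and v_r (r < 4) forced in FromRotation;
      -- σ(s_{4m+r}) is base s r shifted by (a − 1)m
      base : Side → ℕ → Vert n
      base U 0 = U ⟨ 0ℤ ⟩
      base U 1 = V ⟨ 0ℤ ⟩
      base U 2 = V ⟨ α ⟩
      base U _ = U ⟨ α ⟩
      base V 0 = U ⟨ -1ℤ ⟩
      base V 1 = V ⟨ β ⟩
      base V 2 = V ⟨ α - β ⟩
      base V _ = U ⟨ α + 1ℤ ⟩

      σ : Vert n → Vert n
      σ (s , i) = shift (c * + (toℕ i ℕ./ 4)) (base s (toℕ i ℕ.% 4))

      shift-≈ : ∀ {e e′} → e ≈ e′ → ∀ p → shift e p ≡ shift e′ p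
      shift-≈ e≈e′ (s , i) = cong (s ,_) (fromℤ-cong (≈-+ˡ (+ toℕ i) e≈e′))

      -- σ is well defined on ℤ/n because 4 ∣ n and 4 ∣ a − 1
      σ-at : ∀ s m r {z} → r ℕ.< 4 → z ≡ + 4 * m + + r → σ (s ⟨ z ⟩) ≡ shift (c * m) (base s r)
      σ-at s m r {z} r<4 refl = trans (cong (λ r′ → shift (c * + q) (base s r′)) r′≡r) (shift-≈ cq≈cm (base s r))
        where
        k = toℕ (fromℤ z)
        q = k ℕ./ 4
        r′ = k ℕ.% 4
        k≡ : + k ≡ + r′ + + q * + 4
        k≡ = trans (cong +_ (ℕD.m≡m%n+[m/n]*n k 4)) (cong (λ x → + r′ + x) (ℤP.pos-* q 4))
        n∣k-z : + n ∣ + r′ + + q * + 4 - z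
        n∣k-z = subst (λ x → + n ∣ x - z) k≡ (_≈_.∣-diff (toℕ-fromℤ≈ z))
        r′≡r : r′ ≡ r
        r′≡r = Modular.residue-unique 4 (ℕD.m%n<n k 4) r<4
          (Modular.≈-by 4 (∣m∣n⇒∣m+n (∣-trans (∣ᵤ⇒∣ 4∣n) n∣k-z) (∣n⇒∣m*n (m - + q) (∣-refl {+ 4}))) (mod-4 (+ r′) (+ q) m (+ r)))
          where
          mod-4 : ∀ r′ q m r → r′ - r ≡ (r′ + q * + 4 - (+ 4 * m + r)) + (m - q) * + 4
          mod-4 = solve-∀
        cq≈cm : c * + q ≈ c * m
        cq≈cm = ≈-by (∣n⇒∣m*n A (subst (λ r″ → + n ∣ + r″ + + q * + 4 - z) r′≡r n∣k-z)) (factor A (+ q) m (+ r))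
          where
          factor : ∀ A q m r → + 4 * A * q - + 4 * A * m ≡ A * (r + q * + 4 - (+ 4 * m + r))
          factor = solve-∀

      σ-base : ∀ s r → r ℕ.< 4 → σ (s ⟨ + r ⟩) ≡ base s r
      σ-base s r r<4 = trans (σ-at s 0ℤ r r<4 refl) (trans (cong (λ e → shift e (base s r)) (ℤP.*-zeroʳ c)) (shift-zero (base s r)))

      decompose : ∀ (i : Fin n) → + toℕ i ≡ + 4 * + (toℕ i ℕ./ 4) + + (toℕ i ℕ.% 4)
      decompose i = trans (cong +_ (ℕD.m≡m%n+[m/n]*n (toℕ i) 4))
        (trans (ℤP.pos-+ r (q ℕ.* 4)) (trans (ℤP.+-comm (+ r) (+ (q ℕ.* 4))) (cong (_+ + r) (trans (ℤP.pos-* q 4) (ℤP.*-comm (+ q) (+ 4))))))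
        where
        q = toℕ i ℕ./ 4
        r = toℕ i ℕ.% 4

      σ-shift : ∀ m p → σ (shift (+ 4 * m) p) ≡ shift (c * m) (σ p)
      σ-shift m (s , i) = begin
        σ (s ⟨ + toℕ i + + 4 * m ⟩)                ≡⟨ σ-at s (+ q + m) r (ℕD.m%n<n (toℕ i) 4) (trans (cong (_+ + 4 * m) (decompose i)) (regroup (+ q) m (+ r))) ⟩
        shift (c * (+ q + m)) (base s r)           ≡⟨ cong (λ e → shift e (base s r)) (ℤP.*-distribˡ-+ c (+ q) m) ⟩
        shift (c * + q + c * m) (base s r)         ≡⟨ shift-shift (c * m) (c * + q) (base s r) ⟨
        shift (c * m) (shift (c * + q) (base s r)) ∎
        where
        open ≡-Reasoning
        q = toℕ i ℕ./ 4
        r = toℕ i ℕ.% 4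
        regroup : ∀ q m r → + 4 * q + r + + 4 * m ≡ + 4 * (q + m) + r
        regroup = solve-∀

      block-reduction : ∀ {X Y : Vert n → Vert n} → (∀ m → Intertwines (shift (+ 4 * m)) X X) → (∀ m → Intertwines (shift (c * m)) Y Y)
                      → (∀ s r → r ℕ.< 4 → σ (X (s ⟨ + r ⟩)) ≡ Y (σ (s ⟨ + r ⟩))) → Intertwines σ X Y
      block-reduction {X} {Y} shift-X shift-Y on-block = intertwining commute
        where
        open ≡-Reasoning
        from-block : ∀ s i → (s , i) ≡ shift (+ 4 * + (toℕ i ℕ./ 4)) (s ⟨ + (toℕ i ℕ.% 4) ⟩)
        from-block s i = trans (cong (s ,_) (sym (fromℤ-toℕ i)))
          (trans (⟨⟩-≈ s (≈-reflexive (trans (decompose i) (ℤP.+-comm (+ 4 * + q) (+ r))))) (sym (shift-⟨⟩ (+ 4 * + q) s (+ r))))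
          where
          q = toℕ i ℕ./ 4
          r = toℕ i ℕ.% 4
        commute : ∀ p → σ (X p) ≡ Y (σ p)
        commute (s , i) = begin
          σ (X (s , i))                   ≡⟨ cong (λ p → σ (X p)) (from-block s i) ⟩
          σ (X (shift (+ 4 * q) p₀))      ≡⟨ cong σ (commutes (shift-X q) p₀) ⟨
          σ (shift (+ 4 * q) (X p₀))      ≡⟨ σ-shift q (X p₀) ⟩
          shift (c * q) (σ (X p₀))        ≡⟨ cong (shift (c * q)) (on-block s r (ℕD.m%n<n (toℕ i) 4)) ⟩
          shift (c * q) (Y (σ p₀))        ≡⟨ commutes (shift-Y q) (σ p₀) ⟩
          Y (shift (c * q) (σ p₀))        ≡⟨ cong Y (σ-shift q p₀) ⟨
          Y (σ (shift (+ 4 * q) p₀))      ≡⟨ cong (λ p → Y (σ p)) (from-block s i) ⟨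
          Y (σ (s , i))                   ∎
          where
          q = + (toℕ i ℕ./ 4)
          r = toℕ i ℕ.% 4
          p₀ = s ⟨ + r ⟩

      α-odd : Oddℤ α
      α-odd = subst Oddℤ a≡α (odd⇒Oddℤ a-odd)

      β-odd : Oddℤ β
      β-odd = subst Oddℤ b≡β (odd⇒Oddℤ b-odd)

      B-V-even′ : ∀ {z} → Evenℤ z → B (V ⟨ z ⟩) ≡ V ⟨ z + α ⟩
      B-V-even′ {z} e = trans (B-V-even e) (cong (λ x → V ⟨ z + x ⟩) a≡α)

      B-V-odd′ : ∀ {z} → Oddℤ z → B (V ⟨ z ⟩) ≡ V ⟨ z - α ⟩
      B-V-odd′ {z} o = trans (B-V-odd o) (cong (λ x → V ⟨ z - x ⟩) a≡α)

      G-V-even′ : ∀ {z} → Evenℤ z → G (V ⟨ z ⟩) ≡ V ⟨ z + β ⟩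
      G-V-even′ {z} e = trans (G-V-even e) (cong (λ x → V ⟨ z + x ⟩) b≡β)

      G-V-odd′ : ∀ {z} → Oddℤ z → G (V ⟨ z ⟩) ≡ V ⟨ z - β ⟩
      G-V-odd′ {z} o = trans (G-V-odd o) (cong (λ x → V ⟨ z - x ⟩) b≡β)

      σ-base′ : ∀ s r {r<4 : True (r ℕ.<? 4)} → σ (s ⟨ + r ⟩) ≡ base s r
      σ-base′ s r {r<4} = σ-base s r (toWitness r<4)

      in-block : ∀ {X Y : Vert n → Vert n} s r s′ r′ {r<4 : True (r ℕ.<? 4)} {r′<4 : True (r′ ℕ.<? 4)}
               → X (s ⟨ + r ⟩) ≡ s′ ⟨ + r′ ⟩ → base s′ r′ ≡ Y (base s r) → σ (X (s ⟨ + r ⟩)) ≡ Y (σ (s ⟨ + r ⟩))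
      in-block {X} {Y} s r s′ r′ {r<4} {r′<4} X≡ base≡ = begin
        σ (X (s ⟨ + r ⟩))   ≡⟨ cong σ X≡ ⟩
        σ (s′ ⟨ + r′ ⟩)     ≡⟨ σ-base′ s′ r′ {r′<4} ⟩
        base s′ r′          ≡⟨ base≡ ⟩
        Y (base s r)        ≡⟨ cong Y (σ-base′ s r {r<4}) ⟨
        Y (σ (s ⟨ + r ⟩))   ∎
        where open ≡-Reasoning

      out-of-block : ∀ {X Y : Vert n → Vert n} s r s′ m r′ {z} {r<4 : True (r ℕ.<? 4)} {r′<4 : True (r′ ℕ.<? 4)}
                   → X (s ⟨ + r ⟩) ≡ s′ ⟨ z ⟩ → z ≡ + 4 * m + + r′ → shift (c * m) (base s′ r′) ≡ Y (base s r)
                   → σ (X (s ⟨ + r ⟩)) ≡ Y (σ (s ⟨ + r ⟩))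
      out-of-block {X} {Y} s r s′ m r′ {z} {r<4} {r′<4} X≡ z≡ base≡ = begin
        σ (X (s ⟨ + r ⟩))            ≡⟨ cong σ X≡ ⟩
        σ (s′ ⟨ z ⟩)                 ≡⟨ σ-at s′ m r′ (toWitness r′<4) z≡ ⟩
        shift (c * m) (base s′ r′)   ≡⟨ base≡ ⟩
        Y (base s r)                 ≡⟨ cong Y (σ-base′ s r {r<4}) ⟨
        Y (σ (s ⟨ + r ⟩))            ∎
        where open ≡-Reasoning

      shifted : ∀ s x e {y} → x + e ≈ y → shift e (s ⟨ x ⟩) ≡ s ⟨ y ⟩
      shifted s x e x+e≈y = trans (shift-⟨⟩ e s x) (⟨⟩-≈ s x+e≈y)

      base-V : ∀ r → base V r ≡ G (base U r)
      base-V 0 = sym (G-U-even (evenℤ (divides 0ℤ refl)))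
      base-V 1 = sym (trans (G-V-even′ (evenℤ (divides 0ℤ refl))) (cong (V ⟨_⟩) (ℤP.+-identityˡ β)))
      base-V 2 = sym (G-V-odd′ α-odd)
      base-V (suc (suc (suc _))) = sym (G-U-odd α-odd)

      σ-R-block : ∀ s r → r ℕ.< 4 → σ (R (s ⟨ + r ⟩)) ≡ G (σ (s ⟨ + r ⟩))
      σ-R-block U r r<4 = trans (σ-base V r r<4) (trans (base-V r) (cong G (sym (σ-base U r r<4))))
      σ-R-block V r r<4 = trans (σ-base U r r<4) (sym (trans (cong G (trans (σ-base V r r<4) (base-V r))) (G-involutive _)))

      σ-B-block : ∀ s r → r ℕ.< 4 → σ (B (s ⟨ + r ⟩)) ≡ R (σ (s ⟨ + r ⟩))
      σ-B-block U 0 _ = in-block {B} {R} U 0 U 1 (B-U-even (evenℤ (divides 0ℤ refl))) refl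
      σ-B-block U 1 _ = in-block {B} {R} U 1 U 0 (B-U-odd (oddℤ ∣-refl)) refl
      σ-B-block U 2 _ = in-block {B} {R} U 2 U 3 (B-U-even (evenℤ (divides 1ℤ refl))) refl
      σ-B-block U 3 _ = in-block {B} {R} U 3 U 2 (B-U-odd (oddℤ (divides (+ 2) refl))) refl
      σ-B-block V 0 _ = out-of-block {B} {R} V 0 V A 1 (B-V-even′ (evenℤ (divides 0ℤ refl))) (ℤP.+-identityˡ α)
        (shifted V β (c * A) (≈-by n∣E₁ (E₁-id A B₀)))
        where
        E₁-id : ∀ A B → (+ 4 * B + + 3) + + 4 * A * A - -1ℤ ≡ + 4 * (A * A + B + 1ℤ)
        E₁-id = solve-∀
      σ-B-block V 1 _ = out-of-block {B} {R} V 1 V (- A) 0 (B-V-odd′ (oddℤ ∣-refl)) (index A)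
        (shifted U -1ℤ (c * - A) (≈-by (∣m⇒∣-m n∣E₁) (E₁-id A B₀)))
        where
        index : ∀ A → + 1 - (+ 4 * A + 1ℤ) ≡ + 4 * - A + + 0
        index = solve-∀
        E₁-id : ∀ A B → -1ℤ + + 4 * A * - A - (+ 4 * B + + 3) ≡ - (+ 4 * (A * A + B + 1ℤ))
        E₁-id = solve-∀
      σ-B-block V 2 _ = out-of-block {B} {R} V 2 V A 3 (B-V-even′ (evenℤ (divides 1ℤ refl))) (index A)
        (shifted U (α + 1ℤ) (c * A) (≈-by n∣E₁ (E₁-id A B₀)))
        where
        index : ∀ A → + 2 + (+ 4 * A + 1ℤ) ≡ + 4 * A + + 3
        index = solve-∀
        E₁-id : ∀ A B → (+ 4 * A + 1ℤ) + 1ℤ + + 4 * A * A - ((+ 4 * A + 1ℤ) - (+ 4 * B + + 3)) ≡ + 4 * (A * A + B + 1ℤ)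
        E₁-id = solve-∀
      σ-B-block V 3 _ = out-of-block {B} {R} V 3 V (- A) 2 (B-V-odd′ (oddℤ (divides (+ 2) refl))) (index A)
        (shifted V (α - β) (c * - A) (≈-by (∣m⇒∣-m n∣E₁) (E₁-id A B₀)))
        where
        index : ∀ A → + 3 - (+ 4 * A + 1ℤ) ≡ + 4 * - A + + 2
        index = solve-∀
        E₁-id : ∀ A B → (+ 4 * A + 1ℤ) - (+ 4 * B + + 3) + + 4 * A * - A - ((+ 4 * A + 1ℤ) + 1ℤ) ≡ - (+ 4 * (A * A + B + 1ℤ))
        E₁-id = solve-∀
      σ-B-block s (suc (suc (suc (suc r)))) (ℕ.s≤s (ℕ.s≤s (ℕ.s≤s (ℕ.s≤s ()))))

      σ-G-block : ∀ s r → r ℕ.< 4 → σ (G (s ⟨ + r ⟩)) ≡ B (σ (s ⟨ + r ⟩))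
      σ-G-block U 0 _ = out-of-block {G} {B} U 0 U -1ℤ 3 (G-U-even (evenℤ (divides 0ℤ refl))) refl
        (trans (shifted U α (c * -1ℤ) (≈-reflexive (α-c A))) (sym (B-U-even (evenℤ (divides 0ℤ refl)))))
        where
        α-c : ∀ A → + 4 * A + 1ℤ + + 4 * A * -1ℤ ≡ 0ℤ + 1ℤ
        α-c = solve-∀
      σ-G-block U 1 _ = in-block {G} {B} U 1 U 2 (G-U-odd (oddℤ ∣-refl))
        (sym (trans (B-V-even′ (evenℤ (divides 0ℤ refl))) (cong (V ⟨_⟩) (ℤP.+-identityˡ α))))
      σ-G-block U 2 _ = in-block {G} {B} U 2 U 1 (G-U-even (evenℤ (divides 1ℤ refl)))
        (sym (trans (B-V-odd′ α-odd) (cong (V ⟨_⟩) (ℤP.+-inverseʳ α))))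
      σ-G-block U 3 _ = out-of-block {G} {B} U 3 U 1ℤ 0 (G-U-odd (oddℤ (divides (+ 2) refl))) refl
        (trans (shifted U 0ℤ (c * 1ℤ) (≈-reflexive (c-α A))) (sym (B-U-odd α-odd)))
        where
        c-α : ∀ A → 0ℤ + + 4 * A * 1ℤ ≡ + 4 * A + 1ℤ - 1ℤ
        c-α = solve-∀
      σ-G-block V 0 _ = out-of-block {G} {B} V 0 V B₀ 3 (G-V-even′ (evenℤ (divides 0ℤ refl))) (ℤP.+-identityˡ β)
        (trans (shifted U (α + 1ℤ) (c * B₀) (≈-by n∣E₂ (E₂-id A B₀))) (sym (B-U-odd (oddℤ (divides 0ℤ refl)))))
        where
        E₂-id : ∀ A B → (+ 4 * A + 1ℤ) + 1ℤ + + 4 * A * B - (-1ℤ - 1ℤ) ≡ + 4 * (A * B + A + 1ℤ)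
        E₂-id = solve-∀
      σ-G-block V 1 _ = out-of-block {G} {B} V 1 V (- B₀ - 1ℤ) 2 (G-V-odd′ (oddℤ ∣-refl)) (index B₀)
        (trans (shifted V (α - β) (c * (- B₀ - 1ℤ)) (≈-by (∣m⇒∣-m (∣m∣n⇒∣m+n n∣E₂ n∣E₃)) (E₂₃-id A B₀))) (sym (B-V-odd′ β-odd)))
        where
        index : ∀ B → + 1 - (+ 4 * B + + 3) ≡ + 4 * (- B - 1ℤ) + + 2
        index = solve-∀
        E₂₃-id : ∀ A B → (+ 4 * A + 1ℤ) - (+ 4 * B + + 3) + + 4 * A * (- B - 1ℤ) - ((+ 4 * B + + 3) - (+ 4 * A + 1ℤ))
                       ≡ - (+ 4 * (A * B + A + 1ℤ) + + 8 * (B - A))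
        E₂₃-id = solve-∀
      σ-G-block V 2 _ = out-of-block {G} {B} V 2 V (B₀ + 1ℤ) 1 (G-V-even′ (evenℤ (divides 1ℤ refl))) (index B₀)
        (trans (shifted V β (c * (B₀ + 1ℤ)) (≈-by (∣m∣n⇒∣m+n n∣E₂ n∣E₃) (E₂₃-id A B₀))) (sym (B-V-even′ (odd-odd α-odd β-odd))))
        where
        index : ∀ B → + 2 + (+ 4 * B + + 3) ≡ + 4 * (B + 1ℤ) + + 1
        index = solve-∀
        E₂₃-id : ∀ A B → (+ 4 * B + + 3) + + 4 * A * (B + 1ℤ) - ((+ 4 * A + 1ℤ) - (+ 4 * B + + 3) + (+ 4 * A + 1ℤ))
                       ≡ + 4 * (A * B + A + 1ℤ) + + 8 * (B - A)
        E₂₃-id = solve-∀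
      σ-G-block V 3 _ = out-of-block {G} {B} V 3 V (- B₀) 0 (G-V-odd′ (oddℤ (divides (+ 2) refl))) (index B₀)
        (trans (shifted U -1ℤ (c * - B₀) (≈-by (∣m⇒∣-m n∣E₂) (E₂-id A B₀))) (sym (B-U-even (odd+odd α-odd (oddℤ ∣-refl)))))
        where
        index : ∀ B → + 3 - (+ 4 * B + + 3) ≡ + 4 * - B + + 0
        index = solve-∀
        E₂-id : ∀ A B → -1ℤ + + 4 * A * - B - ((+ 4 * A + 1ℤ) + 1ℤ + 1ℤ) ≡ - (+ 4 * (A * B + A + 1ℤ))
        E₂-id = solve-∀
      σ-G-block s (suc (suc (suc (suc r)))) (ℕ.s≤s (ℕ.s≤s (ℕ.s≤s (ℕ.s≤s ()))))

      4m-even : ∀ m → Evenℤ (+ 4 * m)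
      4m-even m = evenℤ (divides (+ 2 * m) (double m))
        where
        double : ∀ m → + 4 * m ≡ + 2 * m * + 2
        double = solve-∀

      cm-even : ∀ m → Evenℤ (c * m)
      cm-even m = evenℤ (divides (+ 2 * A * m) (double A m))
        where
        double : ∀ A m → + 4 * A * m ≡ + 2 * A * m * + 2
        double = solve-∀

      σ-rotation : Rotation σ
      σ-rotation = block-reduction (λ m → shift-R (+ 4 * m)) (λ m → shift-G (cm-even m)) σ-R-block
                 , block-reduction (λ m → shift-B (4m-even m)) (λ m → shift-R (c * m)) σ-B-block
                 , block-reduction (λ m → shift-G (4m-even m)) (λ m → shift-B (cm-even m)) σ-G-block

      σ-u₀ : σ u₀ ≡ u₀
      σ-u₀ = σ-base′ U 0

  -- Number theory

  RotationCondition : ℕ → ℕ → ℕ → Set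
  RotationCondition n a b =
    n ℕ.% 16 ≡ 8
    × Σ ℕ (λ a₀ → Odd a₀ × a ≡ 4 ℕ.* a₀ ℕ.+ 1 × a ℕ.< n ℕ./ 4 ∸ 1 × n ℕDiv.∣ 8 ℕ.* (a₀ ℕ.* a₀ ℕ.+ a₀ ℕ.+ 1))
    × b ≡ n ℕ./ 2 ℕ.+ a ℕ.+ 2

  odd-from-ℤ : ∀ {k} → + 2 ∣ 1ℤ + + k → Odd k
  odd-from-ℤ {k} 2∣1+k 2∣k = 2∤1 (∣m+n∣n⇒∣m {m = 1ℤ} 2∣1+k (∣ᵤ⇒∣ {i = + k} 2∣k))

  -- the two dividends differ by e(a₀ − 1)
  parity-core : ∀ a₀ e → .{{NonZero e}} → + (2 ℕ.* e) ∣ + a₀ * + a₀ + + a₀ + + e + 1ℤ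
              → + (2 ℕ.* e) ∣ + a₀ * (+ a₀ + + e) + + a₀ + 1ℤ → Odd a₀ × Odd e
  parity-core a₀ e d∣X₁ d∣X₂ = odd-from-ℤ 2∣1+A , odd-from-ℤ 2∣1+E
    where
    A = + a₀
    E = + e
    d≡ : + (2 ℕ.* e) ≡ E * + 2
    d≡ = trans (ℤP.pos-* 2 e) (ℤP.*-comm (+ 2) E)
    2∣A-1 : + 2 ∣ A - 1ℤ
    2∣A-1 = *-cancelˡ-∣ E (∣-≡ (subst (_∣ (A * (A + E) + A + 1ℤ - (A * A + A + E + 1ℤ))) d≡ (∣m∣n⇒∣m-n d∣X₂ d∣X₁)) (diff A E))
      where
      diff : ∀ A E → A * (A + E) + A + 1ℤ - (A * A + A + E + 1ℤ) ≡ E * (A - 1ℤ)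
      diff = solve-∀
    2∣1+A : + 2 ∣ 1ℤ + A
    2∣1+A = ∣-≡ (∣m∣n⇒∣m+n 2∣A-1 (∣-refl {+ 2})) (shift-by-2 A)
      where
      shift-by-2 : ∀ A → A - 1ℤ + + 2 ≡ 1ℤ + A
      shift-by-2 = solve-∀
    2∣1+E : + 2 ∣ 1ℤ + E
    2∣1+E = ∣-≡ (∣m∣n⇒∣m-n (∣m∣n⇒∣m-n (∣-trans (divides E d≡) d∣X₁) (∣n⇒∣m*n (A + + 2) 2∣A-1)) (∣-refl {+ 2})) (rest A E)
      where
      rest : ∀ A E → A * A + A + E + 1ℤ - (A + + 2) * (A - 1ℤ) - + 2 ≡ 1ℤ + E
      rest = solve-∀

  module _ {n a b} (rc : RotationCongruences n a b) where

    open RotationCongruences rc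

    private
      M : ℕ
      M = ℕDiv.quotient 4∣n

      n≡M*4 : n ≡ M ℕ.* 4
      n≡M*4 = ℕDiv.m∣n⇒n≡quotient*m 4∣n

      A B : ℤ
      A = + a₀
      B = + b₀

      quarter : ∀ {X} → + n ∣ + 4 * X → + M ∣ X
      quarter n∣4X = *-cancelˡ-∣ (+ 4) (subst (_∣ _) n≡4M n∣4X)
        where
        n≡4M : + n ≡ + 4 * + M
        n≡4M = trans (cong +_ n≡M*4) (trans (ℤP.pos-* M 4) (ℤP.*-comm (+ M) (+ 4)))

      order-bounds : a ℕ.< b ∸ 2 → b ∸ 2 ℕ.< n ∸ a ∸ 2 → a₀ ℕ.< b₀ × b₀ ℕ.+ a₀ ℕ.+ 1 ℕ.< M
      order-bounds a<b-2 b-2<n-a-2 = a₀<b₀ , b₀+a₀+1<M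
        where
        a+2<b : a ℕ.+ 2 ℕ.< b
        a+2<b = <∸⇒+< a b 2 a<b-2
        b+a<n : b ℕ.+ a ℕ.< n
        b+a<n = <∸⇒+< b n a (subst (ℕ._< n ∸ a) (ℕP.m∸n+n≡m (ℕP.≤-trans (ℕP.m≤n+m 2 a) (ℕP.<⇒≤ a+2<b)))
                                   (<∸⇒+< (b ∸ 2) (n ∸ a) 2 b-2<n-a-2))
        a₀<b₀ : a₀ ℕ.< b₀
        a₀<b₀ = ℕP.*-cancelˡ-< 4 a₀ b₀ (ℕP.+-cancelʳ-< 3 (4 ℕ.* a₀) (4 ℕ.* b₀)
          (subst₂ ℕ._<_ (trans (cong (ℕ._+ 2) a≡) (ℕP.+-assoc (4 ℕ.* a₀) 1 2)) b≡ a+2<b))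
        b₀+a₀+1<M : b₀ ℕ.+ a₀ ℕ.+ 1 ℕ.< M
        b₀+a₀+1<M = ℕP.*-cancelˡ-< 4 (b₀ ℕ.+ a₀ ℕ.+ 1) M
          (subst₂ ℕ._<_ (trans (cong₂ ℕ._+_ b≡ a≡) (collect b₀ a₀)) (trans n≡M*4 (ℕP.*-comm M 4)) b+a<n)
          where
          collect : ∀ b₀ a₀ → 4 ℕ.* b₀ ℕ.+ 3 ℕ.+ (4 ℕ.* a₀ ℕ.+ 1) ≡ 4 ℕ.* (b₀ ℕ.+ a₀ ℕ.+ 1)
          collect = NS.solve-∀

      module Bounded (a₀<b₀ : a₀ ℕ.< b₀) (b₀+a₀+1<M : b₀ ℕ.+ a₀ ℕ.+ 1 ℕ.< M) where

        e : ℕ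
        e = b₀ ∸ a₀

        E : ℤ
        E = + e

        b₀≡a₀+e : b₀ ≡ a₀ ℕ.+ e
        b₀≡a₀+e = sym (ℕP.m+[n∸m]≡n (ℕP.<⇒≤ a₀<b₀))

        B≡A+E : B ≡ A + E
        B≡A+E = trans (cong +_ b₀≡a₀+e) (ℤP.pos-+ a₀ e)

        0<e : 0 ℕ.< e
        0<e = ℕP.m<n⇒0<n∸m a₀<b₀

        instance
          e≢0 : NonZero e
          e≢0 = ℕ.>-nonZero 0<e

        M≡2e : M ≡ 2 ℕ.* e
        M≡2e = divisor-of-double M∣2e 0<e e<M
          where
          e<M : e ℕ.< M
          e<M = ℕP.≤-<-trans (ℕP.≤-trans (ℕP.m∸n≤m b₀ a₀) (ℕP.≤-trans (ℕP.m≤m+n b₀ a₀) (ℕP.m≤m+n (b₀ ℕ.+ a₀) 1))) b₀+a₀+1<M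
          regroup : ∀ A E → + 8 * (A + E - A) ≡ + 4 * (+ 2 * E)
          regroup = solve-∀
          M∣2e : M ℕDiv.∣ 2 ℕ.* e
          M∣2e = ∣⇒∣ᵤ (∣-≡ (quarter (∣-≡ n∣E₃ (trans (cong (λ x → + 8 * (x - A)) B≡A+E) (regroup A E)))) (sym (ℤP.pos-* 2 e)))

        2e∣X₁ : + (2 ℕ.* e) ∣ A * A + A + E + 1ℤ
        2e∣X₁ = subst (λ m → + m ∣ A * A + A + E + 1ℤ) M≡2e (∣-≡ (quarter n∣E₁) (trans (cong (λ x → A * A + x + 1ℤ) B≡A+E) (regroup A E)))
          where
          regroup : ∀ A E → A * A + (A + E) + 1ℤ ≡ A * A + A + E + 1ℤ
          regroup = solve-∀

        2e∣X₂ : + (2 ℕ.* e) ∣ A * (A + E) + A + 1ℤ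
        2e∣X₂ = subst (λ m → + m ∣ A * (A + E) + A + 1ℤ) M≡2e (∣-≡ (quarter n∣E₂) (cong (λ x → A * x + A + 1ℤ) B≡A+E))

        n≡8e : n ≡ 8 ℕ.* e
        n≡8e = trans n≡M*4 (trans (cong (ℕ._* 4) M≡2e) (regroup e))
          where
          regroup : ∀ e → 2 ℕ.* e ℕ.* 4 ≡ 8 ℕ.* e
          regroup = NS.solve-∀

        n%16≡8 : n ℕ.% 16 ≡ 8
        n%16≡8 = from-odd (odd⇒2f+1 (proj₂ (parity-core a₀ e 2e∣X₁ 2e∣X₂)))
          where
          regroup : ∀ f → 8 ℕ.* (2 ℕ.* f ℕ.+ 1) ≡ 8 ℕ.+ f ℕ.* 16
          regroup = NS.solve-∀
          from-odd : Σ ℕ (λ f → e ≡ 2 ℕ.* f ℕ.+ 1) → n ℕ.% 16 ≡ 8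
          from-odd (f , e≡2f+1) = trans (cong (ℕ._% 16) (trans n≡8e (trans (cong (8 ℕ.*_) e≡2f+1) (regroup f))))
                                        (ℕD.[m+kn]%n≡m%n 8 f 16)

        a<n/4-1 : a ℕ.< n ℕ./ 4 ∸ 1
        a<n/4-1 = +<⇒<∸ a (n ℕ./ 4) 1 (subst₂ ℕ._<_ (sym a+1≡) (sym n/4≡2e) (ℕP.*-monoʳ-< 2 2a₀+1<e))
          where
          n/4≡2e : n ℕ./ 4 ≡ 2 ℕ.* e
          n/4≡2e = trans (cong (ℕ._/ 4) (trans n≡M*4 (cong (ℕ._* 4) M≡2e))) (ℕD.m*n/n≡m (2 ℕ.* e) 4)
          regroup₁ : ∀ a₀ → 4 ℕ.* a₀ ℕ.+ 1 ℕ.+ 1 ≡ 2 ℕ.* (2 ℕ.* a₀ ℕ.+ 1)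
          regroup₁ = NS.solve-∀
          a+1≡ : a ℕ.+ 1 ≡ 2 ℕ.* (2 ℕ.* a₀ ℕ.+ 1)
          a+1≡ = trans (cong (ℕ._+ 1) a≡) (regroup₁ a₀)
          regroup₂ : ∀ a₀ e → a₀ ℕ.+ e ℕ.+ a₀ ℕ.+ 1 ≡ e ℕ.+ (2 ℕ.* a₀ ℕ.+ 1)
          regroup₂ = NS.solve-∀
          double : ∀ e → 2 ℕ.* e ≡ e ℕ.+ e
          double = NS.solve-∀
          2a₀+1<e : 2 ℕ.* a₀ ℕ.+ 1 ℕ.< e
          2a₀+1<e = ℕP.+-cancelˡ-< e (2 ℕ.* a₀ ℕ.+ 1) e
            (subst₂ ℕ._<_ (trans (cong (λ x → x ℕ.+ a₀ ℕ.+ 1) b₀≡a₀+e) (regroup₂ a₀ e)) (trans M≡2e (double e)) b₀+a₀+1<M)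

        n∣8X : n ℕDiv.∣ 8 ℕ.* (a₀ ℕ.* a₀ ℕ.+ a₀ ℕ.+ 1)
        n∣8X = subst (ℕDiv._∣ 8 ℕ.* (a₀ ℕ.* a₀ ℕ.+ a₀ ℕ.+ 1)) (sym n≡8e) (ℕDiv.*-monoʳ-∣ 8 e∣X)
          where
          drop-e : ∀ A E → A * A + A + E + 1ℤ - E ≡ A * A + A + 1ℤ
          drop-e = solve-∀
          e∣X : e ℕDiv.∣ a₀ ℕ.* a₀ ℕ.+ a₀ ℕ.+ 1
          e∣X = ∣⇒∣ᵤ (∣-≡ (∣m∣n⇒∣m-n (∣-trans (divides (+ 2) (ℤP.pos-* 2 e)) 2e∣X₁) (∣-refl {E}))
                           (trans (drop-e A E) (sym (pos-x²+x+1 a₀))))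

        b≡n/2+a+2 : b ≡ n ℕ./ 2 ℕ.+ a ℕ.+ 2
        b≡n/2+a+2 = trans b≡ (trans (cong (λ x → 4 ℕ.* x ℕ.+ 3) b₀≡a₀+e) (sym (trans (cong₂ (λ x y → x ℕ.+ y ℕ.+ 2) n/2≡4e a≡) (regroup a₀ e))))
          where
          double : ∀ e → 8 ℕ.* e ≡ 4 ℕ.* e ℕ.* 2
          double = NS.solve-∀
          n/2≡4e : n ℕ./ 2 ≡ 4 ℕ.* e
          n/2≡4e = trans (cong (ℕ._/ 2) (trans n≡8e (double e))) (ℕD.m*n/n≡m (4 ℕ.* e) 2)
          regroup : ∀ a₀ e → 4 ℕ.* e ℕ.+ (4 ℕ.* a₀ ℕ.+ 1) ℕ.+ 2 ≡ 4 ℕ.* (a₀ ℕ.+ e) ℕ.+ 3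
          regroup = NS.solve-∀

        condition : RotationCondition n a b
        condition = n%16≡8 , (a₀ , proj₁ (parity-core a₀ e 2e∣X₁ 2e∣X₂) , a≡ , a<n/4-1 , n∣8X) , b≡n/2+a+2

    congruences⇒condition : a ℕ.< b ∸ 2 → b ∸ 2 ℕ.< n ∸ a ∸ 2 → RotationCondition n a b
    congruences⇒condition a<b-2 b-2<n-a-2 = Bounded.condition (proj₁ bounds) (proj₂ bounds)
      where
      bounds = order-bounds a<b-2 b-2<n-a-2

  private
    module FromCondition {n a b} (n%16≡8 : n ℕ.% 16 ≡ 8) (a₀ : ℕ) (a₀-odd : Odd a₀) (a≡ : a ≡ 4 ℕ.* a₀ ℕ.+ 1)
                         (n∣8X : n ℕDiv.∣ 8 ℕ.* (a₀ ℕ.* a₀ ℕ.+ a₀ ℕ.+ 1)) (b≡n/2+a+2 : b ≡ n ℕ./ 2 ℕ.+ a ℕ.+ 2) where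

      K : ℕ
      K = 2 ℕ.* (n ℕ./ 16) ℕ.+ 1

      X : ℕ
      X = a₀ ℕ.* a₀ ℕ.+ a₀ ℕ.+ 1

      n≡8K : n ≡ 8 ℕ.* K
      n≡8K = trans (ℕD.m≡m%n+[m/n]*n n 16) (trans (cong (ℕ._+ n ℕ./ 16 ℕ.* 16) n%16≡8) (collect (n ℕ./ 16)))
        where
        collect : ∀ f → 8 ℕ.+ f ℕ.* 16 ≡ 8 ℕ.* (2 ℕ.* f ℕ.+ 1)
        collect = NS.solve-∀

      b≡ : b ≡ 4 ℕ.* (K ℕ.+ a₀) ℕ.+ 3
      b≡ = trans b≡n/2+a+2 (trans (cong₂ (λ x y → x ℕ.+ y ℕ.+ 2) n/2≡4K a≡) (collect K a₀))
        where
        double : ∀ K → 8 ℕ.* K ≡ 4 ℕ.* K ℕ.* 2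
        double = NS.solve-∀
        n/2≡4K : n ℕ./ 2 ≡ 4 ℕ.* K
        n/2≡4K = trans (cong (ℕ._/ 2) (trans n≡8K (double K))) (ℕD.m*n/n≡m (4 ℕ.* K) 2)
        collect : ∀ K a₀ → 4 ℕ.* K ℕ.+ (4 ℕ.* a₀ ℕ.+ 1) ℕ.+ 2 ≡ 4 ℕ.* (K ℕ.+ a₀) ℕ.+ 3
        collect = NS.solve-∀

      K∣X : K ℕDiv.∣ X
      K∣X = ℕDiv.*-cancelˡ-∣ 8 (subst (ℕDiv._∣ 8 ℕ.* X) n≡8K n∣8X)

      s : ℕ
      s = ℕDiv.quotient K∣X

      X≡sK : X ≡ s ℕ.* K
      X≡sK = ℕDiv.m∣n⇒n≡quotient*m K∣X

      p : ℕ
      p = proj₁ (odd⇒2f+1 a₀-odd)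

      a₀≡2p+1 : a₀ ≡ 2 ℕ.* p ℕ.+ 1
      a₀≡2p+1 = proj₂ (odd⇒2f+1 a₀-odd)

      X-odd : Odd X
      X-odd 2∣X = 1-odd (ℕDiv.∣m+n∣m⇒∣n (subst (2 ℕDiv.∣_) X≡ 2∣X) (ℕDiv.n∣m*n (2 ℕ.* p ℕ.* p ℕ.+ 3 ℕ.* p ℕ.+ 1)))
        where
        expand : ∀ p → (2 ℕ.* p ℕ.+ 1) ℕ.* (2 ℕ.* p ℕ.+ 1) ℕ.+ (2 ℕ.* p ℕ.+ 1) ℕ.+ 1 ≡ (2 ℕ.* p ℕ.* p ℕ.+ 3 ℕ.* p ℕ.+ 1) ℕ.* 2 ℕ.+ 1
        expand = NS.solve-∀
        X≡ : X ≡ (2 ℕ.* p ℕ.* p ℕ.+ 3 ℕ.* p ℕ.+ 1) ℕ.* 2 ℕ.+ 1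
        X≡ = trans (cong (λ x → x ℕ.* x ℕ.+ x ℕ.+ 1) a₀≡2p+1) (expand p)

      s-odd : Odd s
      s-odd 2∣s = X-odd (subst (2 ℕDiv.∣_) (sym X≡sK) (ℕDiv.∣m⇒∣m*n K 2∣s))

      w : ℕ
      w = proj₁ (odd⇒2f+1 s-odd)

      s≡2w+1 : s ≡ 2 ℕ.* w ℕ.+ 1
      s≡2w+1 = proj₂ (odd⇒2f+1 s-odd)

      A P W Kℤ : ℤ
      A = + a₀
      P = + p
      W = + w
      Kℤ = + K

      n≡ : + n ≡ + 8 * Kℤ
      n≡ = trans (cong +_ n≡8K) (ℤP.pos-* 8 K)

      X≡[2W+1]K : A * A + A + 1ℤ ≡ (+ 2 * W + 1ℤ) * Kℤ
      X≡[2W+1]K = trans (sym (pos-x²+x+1 a₀))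
        (trans (cong +_ (trans X≡sK (cong (ℕ._* K) s≡2w+1))) (trans (ℤP.pos-* (2 ℕ.* w ℕ.+ 1) K) (cong (_* Kℤ) (pos-kx+r 2 w 1))))

      E₁-quotient : + 4 * (A * A + + (K ℕ.+ a₀) + 1ℤ) ≡ (W + 1ℤ) * + n
      E₁-quotient = begin
        + 4 * (A * A + + (K ℕ.+ a₀) + 1ℤ)          ≡⟨ cong (λ x → + 4 * (A * A + x + 1ℤ)) (ℤP.pos-+ K a₀) ⟩
        + 4 * (A * A + (Kℤ + A) + 1ℤ)              ≡⟨ regroup A Kℤ ⟩
        + 4 * ((A * A + A + 1ℤ) + Kℤ)              ≡⟨ cong (λ x → + 4 * (x + Kℤ)) X≡[2W+1]K ⟩
        + 4 * ((+ 2 * W + 1ℤ) * Kℤ + Kℤ)           ≡⟨ factor W Kℤ ⟩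
        (W + 1ℤ) * (+ 8 * Kℤ)                      ≡⟨ cong ((W + 1ℤ) *_) n≡ ⟨
        (W + 1ℤ) * + n                             ∎
        where
        open ≡-Reasoning
        regroup : ∀ A K → + 4 * (A * A + (K + A) + 1ℤ) ≡ + 4 * ((A * A + A + 1ℤ) + K)
        regroup = solve-∀
        factor : ∀ W K → + 4 * ((+ 2 * W + 1ℤ) * K + K) ≡ (W + 1ℤ) * (+ 8 * K)
        factor = solve-∀

      E₂-quotient : + 4 * (A * + (K ℕ.+ a₀) + A + 1ℤ) ≡ (W + P + 1ℤ) * + n
      E₂-quotient = begin
        + 4 * (A * + (K ℕ.+ a₀) + A + 1ℤ)                    ≡⟨ cong (λ x → + 4 * (A * x + A + 1ℤ)) (ℤP.pos-+ K a₀) ⟩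
        + 4 * (A * (Kℤ + A) + A + 1ℤ)                        ≡⟨ regroup A Kℤ ⟩
        + 4 * ((A * A + A + 1ℤ) + A * Kℤ)                    ≡⟨ cong (λ x → + 4 * (x + A * Kℤ)) X≡[2W+1]K ⟩
        + 4 * ((+ 2 * W + 1ℤ) * Kℤ + A * Kℤ)                 ≡⟨ cong (λ x → + 4 * ((+ 2 * W + 1ℤ) * Kℤ + x * Kℤ)) A≡2P+1 ⟩
        + 4 * ((+ 2 * W + 1ℤ) * Kℤ + (+ 2 * P + 1ℤ) * Kℤ)    ≡⟨ factor W P Kℤ ⟩
        (W + P + 1ℤ) * (+ 8 * Kℤ)                            ≡⟨ cong ((W + P + 1ℤ) *_) n≡ ⟨
        (W + P + 1ℤ) * + n                                   ∎
        where
        open ≡-Reasoning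
        A≡2P+1 : A ≡ + 2 * P + 1ℤ
        A≡2P+1 = trans (cong +_ a₀≡2p+1) (pos-kx+r 2 p 1)
        regroup : ∀ A K → + 4 * (A * (K + A) + A + 1ℤ) ≡ + 4 * ((A * A + A + 1ℤ) + A * K)
        regroup = solve-∀
        factor : ∀ W P K → + 4 * ((+ 2 * W + 1ℤ) * K + (+ 2 * P + 1ℤ) * K) ≡ (W + P + 1ℤ) * (+ 8 * K)
        factor = solve-∀

      E₃-quotient : + 8 * (+ (K ℕ.+ a₀) - A) ≡ 1ℤ * + n
      E₃-quotient = trans (cong (λ x → + 8 * (x - A)) (ℤP.pos-+ K a₀)) (trans (cancel Kℤ A) (cong (1ℤ *_) (sym n≡)))
        where
        cancel : ∀ K A → + 8 * (K + A - A) ≡ 1ℤ * (+ 8 * K)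
        cancel = solve-∀

      congruences : RotationCongruences n a b
      congruences = record
        { a₀ = a₀ ; b₀ = K ℕ.+ a₀ ; 4∣n = ℕDiv.divides (2 ℕ.* K) (trans n≡8K (regroup K)) ; a≡ = a≡ ; b≡ = b≡
        ; n∣E₁ = divides (W + 1ℤ) E₁-quotient ; n∣E₂ = divides (W + P + 1ℤ) E₂-quotient ; n∣E₃ = divides 1ℤ E₃-quotient }
        where
        regroup : ∀ K → 8 ℕ.* K ≡ 2 ℕ.* K ℕ.* 4
        regroup = NS.solve-∀

  condition⇒congruences : ∀ {n a b} → RotationCondition n a b → RotationCongruences n a b
  condition⇒congruences (n%16≡8 , (a₀ , a₀-odd , a≡ , _ , n∣8X) , b≡n/2+a+2) =
    FromCondition.congruences n%16≡8 a₀ a₀-odd a≡ n∣8X b≡n/2+a+2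

  v₀vₐ∈B⇒x≡a : ∀ {n a b} {{_ : NonZero n}} → Odd a → a ℕ.< b → b ℕ.< n
             → ((i j : Fin n) → toℕ i ≡ 0 → toℕ j ≡ a → InB n a b (V , i) (V , j)) → CondA n a b
  v₀vₐ∈B⇒x≡a {n} {a} {b} a-odd a<b b<n v₀vₐ∈B = by-cases (v₀vₐ∈B v₀ vₐ toℕ-v₀ toℕ-vₐ)
    where
    open Modular n
    v₀ vₐ : Fin n
    v₀ = fromℤ 0ℤ
    vₐ = fromℤ (+ a)
    toℕ-v₀ : toℕ v₀ ≡ 0
    toℕ-v₀ = toℕ-fromℤ (ℕ.>-nonZero⁻¹ n)
    toℕ-vₐ : toℕ vₐ ≡ a
    toℕ-vₐ = toℕ-fromℤ (ℕP.<-trans a<b b<n)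
    by-cases : InB n a b (V , v₀) (V , vₐ) → CondA n a b
    by-cases (inj₁ (inj₁ (x≡a , _))) = x≡a
    by-cases (inj₁ (inj₂ (_ , _ , st))) = ⊥-elim (ℕP.<-irrefl a≡b a<b)
      where
      a≡b : a ≡ b
      a≡b = trans (sym toℕ-vₐ) (trans (cong toℕ (Equivalence.to (StepTo⇔ b v₀ vₐ) st))
                  (trans (cong (λ k → toℕ (fromℤ (+ k + + b))) toℕ-v₀) (toℕ-fromℤ b<n)))
    by-cases (inj₂ (inj₁ (_ , vₐ-even , _))) = ⊥-elim (a-odd (subst Even toℕ-vₐ vₐ-even))
    by-cases (inj₂ (inj₂ (_ , vₐ-even , _))) = ⊥-elim (a-odd (subst Even toℕ-vₐ vₐ-even))

open ColourRotations

open import Defs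
open import Data.Nat using (ℕ; suc; _+_; _*_; _∸_; _<_; _≤_; _/_; _%_)
open import Data.Nat.Divisibility using (_∣_)
open import Data.Fin using (Fin; toℕ)
open import Data.Product using (Σ; _×_; _,_)
open import Relation.Binary.PropositionalEquality using (_≡_)
open import Function.Bundles using (_⇔_; mk⇔)
import Function.Properties.Equivalence as ⇔

proposition7p1 : (n a b : ℕ) → Even n → 4 ≤ n → Odd a → Odd b → 0 < a → a < b → b < n
    → Feasible n a b → 1 < a
    → ((i j : Fin n) → toℕ i ≡ 0 → toℕ j ≡ a → InB n a b (V , i) (V , j))
    → (Σ (Vert n → Vert n) (λ σ → IsAutomorphism n a b σ × FixesU0 n σ × CyclicRBG n a b σ))
      ⇔ (n % 16 ≡ 8
         × Σ ℕ (λ a₀ → Odd a₀ × a ≡ 4 * a₀ + 1 × a < n / 4 ∸ 1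
                       × n ∣ 8 * (a₀ * a₀ + a₀ + 1))
         × b ≡ n / 2 + a + 2)
proposition7p1 0 a b _ () _ _ _ _ _ _ _ _
proposition7p1 n@(suc _) a b n-even _ a-odd b-odd _ a<b b<n (_ , _ , _ , _ , a<b-2 , b-2<n-a-2) _ v₀vₐ∈B =
  ⇔.trans colour-rotating-automorphism⇔rotation (mk⇔ to from)
  where
  open Graph n n-even a b a-odd b-odd (v₀vₐ∈B⇒x≡a a-odd a<b b<n v₀vₐ∈B)
  to : Σ (Vert n → Vert n) (λ σ → Rotation σ × σ u₀ ≡ u₀) → RotationCondition n a b
  to (τ , τ-rotation , τ-u₀) = congruences⇒condition (FromRotation.congruences τ τ-rotation τ-u₀) a<b-2 b-2<n-a-2
  from : RotationCondition n a b → Σ (Vert n → Vert n) (λ σ → Rotation σ × σ u₀ ≡ u₀)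
  from condition = σ , σ-rotation , σ-u₀
    where open FromCongruences (condition⇒congruences condition)
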